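{- Fix an integer $n\geq 2$. Let $p_k$ denote the $k$-th prime, $g(k)=p_{k+1}-p_k$, $l_k=p_kp_{k+1}$, and $g=\liminf_{k\to\infty} g(k)$ (a finite number). Let $(\varphi(k))_{k\in\mathbb{N}}$ and $(\psi(k))_{k\in\mathbb{N}}$ be increasing sequences of positive integers with $\lim_{k\to\infty}g(\varphi(k))=\infty$ and $\lim_{k\to\infty}g(\psi(k))=g$. Then, as $k\to\infty$, $$\varepsilon_2(n,l_{\varphi(k)})\sim n^{\frac{3l_{\varphi(k)}}{\delta(l_{\varphi(k)})}}\qquad\text{and}\qquad \varepsilon_2(n,l_{\psi(k)})\sim n^{\frac{3l_{\psi(k)}}{\delta(l_{\psi(k)})}}\left(n^{ -3g}+1\right),$$ where $a_k\sim b_k$ means $a_k/b_k\to1$.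
   Context: $\Lambda(l)=\{d\ :\ d\mid l,\ d\not\equiv 0 \pmod 3,\ d\geq 4\}$ and $\delta(l)=\min\Lambda(l)$. A nonempty word $u$ is primitive if $u=v^m$ with $m$ a positive integer implies $m=1$; $|u|$ is its length. For an alphabet $\mathcal{A}$ of size $n$, $\varepsilon_2(n,l)$ is the number of pairs $(p,q)$ of primitive words over $\mathcal{A}$ with $|p|=2|q|=2l$, $pq$ not primitive, for which there exist nonempty words $\alpha,\beta$ and an integer $s\geq1$ with $\alpha\beta$ primitive, $q=(\alpha\beta)^{s}\alpha$, and either ($p=(\beta\alpha)^{2s}\beta$ and $|\beta|=2|\alpha|$) or ($p=(\beta\alpha)^{2s+1}\beta$ and $|\alpha|=2|\beta|$). -}

module Defs where

open import Data.Nat as ℕ using (ℕ; zero; suc; _+_; _*_; _∸_; _^_; _≤_; _<_; _≥_; NonZero; pred)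
open import Data.Nat.Properties using (m^n≢0)
open import Data.Nat.Divisibility using (_∣_; _∣?_)
open import Data.Nat.DivMod using (_/_)
open import Data.Nat.Primality using (Prime)
open import Data.Integer using (+_)
open import Data.Rational as ℚ using (ℚ; 0ℚ; 1ℚ)
open import Data.Fin using (Fin)
open import Data.List using (List; []; _∷_; _++_; length; concat; replicate; filter; upTo)
open import Data.List.Membership.Propositional using (_∈_)
open import Data.List.Relation.Unary.Unique.Propositional using (Unique)
open import Data.Product using (Σ; ∃; ∃-syntax; _×_; _,_)
open import Data.Sum using (_⊎_)
open import Relation.Nullary using (¬_; ¬?)
open import Relation.Nullary.Decidable using (_×-dec_)
open import Relation.Binary.PropositionalEquality using (_≡_; _≢_)
open import Function.Bundles using (_⇔_)

Word : ℕ → Set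
Word n = List (Fin n)

_^ʷ_ : ∀ {n} → Word n → ℕ → Word n
u ^ʷ m = concat (replicate m u)

Primitive : ∀ {n} → Word n → Set
Primitive {n} u = (u ≢ []) × (∀ (v : Word n) (m : ℕ) → 1 ≤ m → u ≡ v ^ʷ m → m ≡ 1)

Eps2Pair : (n l : ℕ) → Word n × Word n → Set
Eps2Pair n l (p , q) =
  Primitive p × Primitive q ×
  length p ≡ 2 * l × length q ≡ l ×
  ¬ Primitive (p ++ q) ×
  ∃[ α ] ∃[ β ] ∃[ s ]
    ( (α ≢ []) × (β ≢ []) × (1 ≤ s) × Primitive (α ++ β)
    × q ≡ (α ++ β) ^ʷ s ++ α
    × ( (p ≡ (β ++ α) ^ʷ (2 * s) ++ β × length β ≡ 2 * length α)
      ⊎ (p ≡ (β ++ α) ^ʷ (2 * s + 1) ++ β × length α ≡ 2 * length β)))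

HasCard : ∀ {A : Set} → (A → Set) → ℕ → Set
HasCard {A} P c =
  Σ (List A) λ xs → Unique xs × (∀ x → (x ∈ xs) ⇔ P x) × length xs ≡ c

-- δ(l) = min Λ(l),  Λ(l) = { d : d ∣ l, 3 ∤ d, d ≥ 4 }.
-- Computed as the first element of Λ(l) in the ascending list 0,…,l;
-- convention: δ(l) = 0 when Λ(l) = ∅ (only finitely many relevant l).

δ : ℕ → ℕ
δ l with filter (λ d → (4 ℕ.≤? d) ×-dec ((d ∣? l) ×-dec ¬? (3 ∣? d))) (upTo (suc l))
... | []    = 0
... | d ∷ _ = d

-- the exponent 3l / δ(l)  (0 by convention when δ(l) = 0)
expo : ℕ → ℕ
expo l with δ l
... | zero  = 0
... | suc d = (3 * l) / suc d

toℚ : ℕ → ℚ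
toℚ m = (+ m) ℚ./ 1

-- n^(-k) as a rational (0 by convention when n = 0; not used then)
invPow : ℕ → ℕ → ℚ
invPow zero    k = 0ℚ
invPow (suc m) k = ℚ._/_ (+ 1) (suc m ^ k) {{m^n≢0 (suc m) k}}

-- a k ~ b k  (as k → ∞), for b eventually positive:
-- for every rational ε > 0, eventually |a k - b k| ≤ ε · b k,
-- i.e. |a k / b k - 1| ≤ ε.
_∼_ : (ℕ → ℚ) → (ℕ → ℚ) → Set
a ∼ b = ∀ (ε : ℚ) → 0ℚ ℚ.< ε →
  ∃[ K ] ∀ k → K ≤ k → ℚ.∣ a k ℚ.- b k ∣ ℚ.≤ ε ℚ.* b k

-- p enumerates the primes, 1-indexed: p 1 = 2, p 2 = 3, …  (p 0 is unused)
IsPrimeEnum : (ℕ → ℕ) → Set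
IsPrimeEnum p =
  (∀ k → Prime (p (suc k))) ×
  (∀ k → p (suc k) < p (suc (suc k))) ×
  (∀ q → Prime q → ∃[ k ] p (suc k) ≡ q)

StrictlyIncreasing : (ℕ → ℕ) → Set
StrictlyIncreasing f = ∀ k → f k < f (suc k)

IsLiminf : (ℕ → ℕ) → ℕ → Set
IsLiminf f g0 =
  (∃[ K ] ∀ k → K ≤ k → g0 ≤ f k) × (∀ K → ∃[ k ] K ≤ k × f k ≡ g0)

TendsToInfinity : (ℕ → ℕ) → Set
TendsToInfinity f = ∀ M → ∃[ K ] ∀ k → K ≤ k → M ≤ f k

-- f k → c  (for ℕ-valued sequences: eventually equal to c)
TendsTo : (ℕ → ℕ) → ℕ → Set
TendsTo f c = ∃[ K ] ∀ k → K ≤ k → f k ≡ c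

-- A pair counted by ε₂(n, l) is determined by the word w = αβ, of length 3t, and a factorisation
-- l = d t with d ≥ 4 (Eps2Pair⇒≡pair).  Conversely, if w is primitive, d ≥ 6 and 3 ∤ d, the pair
-- built from (d, t, w) is counted: by a weak Fine–Wilf argument, a second period of p or q would give
-- w a proper period dividing |w|.  For l = P Q with primes 7 ≤ P < Q only t ∈ {1, P, Q} occur, so
--   n^(3P) + n^(3Q) - 2 n^⌊3P/2⌋ - 2 n^⌊3Q/2⌋  ≤  ε₂(n, P Q)  ≤  n^3 + n^(3P) + n^(3Q),
-- the error counting the at most 2 n^⌊L/2⌋ proper powers of length L.  As δ(P Q) = P, the main term
-- n^(3l/δ(l)) is n^(3Q); it absorbs n^(3P) when Q - P → ∞, and n^(3P) = n^(3Q) n^(-3g) when Q - P = g.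

module Submission where

open import Defs
open import Data.Nat using (ℕ; suc; _*_; _∸_; _^_; _≤_)
open import Data.Rational using (1ℚ) renaming (_+_ to _+ℚ_; _*_ to _*ℚ_)
open import Data.Product using (_×_)

open import Data.Nat using (zero; _+_; _<_; z≤n; s≤s; ⌊_/2⌋; _⊓_; _⊔_; ∣_-_∣; _<?_; _≤?_; _≟_; >-nonZero; nonTrivial⇒n>1)
open import Data.Nat.Properties
open import Data.Nat.Divisibility using (_∣_; _∣?_; divides; ∣-refl; ∣-trans; ∣m∣n⇒∣m+n; ∣⇒≤; m∣m*n; *-cancelʳ-∣; *-cancelˡ-∣)
open import Data.Nat.DivMod using (_/_; _%_; m*n/n≡m; m*n%n≡0; [m+kn]%n≡m%n; +-distrib-/; m<n⇒m%n≡m; m<n⇒m/n≡0; m≡m%n+[m/n]*n; m%n<n; m≥n⇒m/n>0)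
open import Data.Nat.Primality using (Prime; prime?; euclidsLemma; prime⇒irreducible; prime⇒nonZero; prime⇒nonTrivial)
open import Data.Nat.Coprimality using (Coprime; coprime-divisor)
open import Data.Nat.Tactic.RingSolver using (solve-∀)
open import Algebra.Properties.CommutativeSemigroup +-commutativeSemigroup using () renaming (interchange to +-interchange)
open import Data.List using (List; []; _∷_; _++_; length; take; drop; map; filter; cartesianProductWith; allFin; upTo; applyUpTo)
open import Data.List.Properties
  using (length-++; length-++-comm; ++-assoc; ++-identityʳ; take++drop≡id; length-take; length-drop; length-map; length-tabulate;
         filter-++; filter-none; filter-accept; ≡-dec)
open import Data.List.Membership.Propositional using (_∈_; _∉_)
open import Data.List.Membership.Propositional.Properties
open import Data.List.Membership.DecPropositional using () renaming (_∈?_ to ∈-dec)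
open import Data.List.Relation.Unary.Any using (here; there)
import Data.List.Relation.Unary.All as All
open import Data.List.Relation.Unary.Unique.Propositional using (Unique; []; _∷_)
import Data.List.Relation.Unary.Unique.Propositional.Properties as UniqueP
open import Data.List.Relation.Binary.Subset.Propositional using (_⊆_)
open import Data.Fin using (Fin)
import Data.Fin as Fin
open import Data.Maybe using (Maybe; just; nothing)
open import Data.Product using (∃-syntax; _,_; proj₁; proj₂)
import Data.Product as Product
open import Data.Sum using (_⊎_; inj₁; inj₂; [_,_]′)
import Data.Sum as Sum
open import Data.Empty using (⊥-elim)
import Data.Integer as ℤ
import Data.Integer.Properties as ℤₚ
import Data.Rational as ℚ
import Data.Rational.Properties as ℚₚ
import Data.Rational.Unnormalised as ℚᵘ
import Data.Rational.Unnormalised.Properties as ℚᵘₚ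
open import Data.Rational.Solver using () renaming (module +-*-Solver to ℚ-Solver)
open import Function.Bundles using (Equivalence)
open import Relation.Nullary using (¬_; ¬?; yes; no; Dec)
open import Relation.Nullary.Decidable using (from-yes; _×-dec_)
open import Relation.Unary using (Decidable)
open import Relation.Unary.Properties using (∁?)
open import Relation.Binary.Definitions using (tri<; tri≈; tri>)
open import Relation.Binary.PropositionalEquality

private variable
  A : Set
  n : ℕ

-- Powers and periods of words

length-^ʷ : (u : Word n) (m : ℕ) → length (u ^ʷ m) ≡ m * length u
length-^ʷ u zero    = refl
length-^ʷ u (suc m) = trans (length-++ u) (cong (length u +_) (length-^ʷ u m))

^ʷ-+ : (u : Word n) (a b : ℕ) → u ^ʷ a ++ u ^ʷ b ≡ u ^ʷ (a + b)
^ʷ-+ u zero    b = refl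
^ʷ-+ u (suc a) b = trans (++-assoc u (u ^ʷ a) (u ^ʷ b)) (cong (u ++_) (^ʷ-+ u a b))

++-^ʷ-conjugate : (α β : Word n) (s : ℕ) → β ++ (α ++ β) ^ʷ s ≡ (β ++ α) ^ʷ s ++ β
++-^ʷ-conjugate α β zero    = ++-identityʳ β
++-^ʷ-conjugate α β (suc s) = begin
  β ++ ((α ++ β) ++ (α ++ β) ^ʷ s)   ≡⟨ cong (β ++_) (++-assoc α β _) ⟩
  β ++ (α ++ (β ++ (α ++ β) ^ʷ s))   ≡⟨ cong (λ z → β ++ (α ++ z)) (++-^ʷ-conjugate α β s) ⟩
  β ++ (α ++ ((β ++ α) ^ʷ s ++ β))   ≡⟨ sym (++-assoc β α _) ⟩
  (β ++ α) ++ ((β ++ α) ^ʷ s ++ β)   ≡⟨ sym (++-assoc (β ++ α) _ β) ⟩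
  ((β ++ α) ++ (β ++ α) ^ʷ s) ++ β   ∎
  where open ≡-Reasoning

take-length-++ : (xs ys : List A) → take (length xs) (xs ++ ys) ≡ xs
take-length-++ []       ys = refl
take-length-++ (x ∷ xs) ys = cong (x ∷_) (take-length-++ xs ys)

drop-length-++ : (xs ys : List A) → drop (length xs) (xs ++ ys) ≡ ys
drop-length-++ []       ys = refl
drop-length-++ (x ∷ xs) ys = drop-length-++ xs ys

take-length-^ʷ : (w x : Word n) (s : ℕ) → 1 ≤ s → take (length w) (w ^ʷ s ++ x) ≡ w
take-length-^ʷ w x (suc s) _ = trans (cong (take (length w)) (++-assoc w (w ^ʷ s) x)) (take-length-++ w _)

nth : List A → ℕ → Maybe A
nth []       i       = nothing
nth (x ∷ xs) zero    = just x
nth (x ∷ xs) (suc i) = nth xs i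

nth-ext : (xs ys : List A) → (∀ i → nth xs i ≡ nth ys i) → xs ≡ ys
nth-ext []       []       h = refl
nth-ext []       (y ∷ ys) h with () ← h 0
nth-ext (x ∷ xs) []       h with () ← h 0
nth-ext (x ∷ xs) (y ∷ ys) h with refl ← h 0 = cong (x ∷_) (nth-ext xs ys (λ i → h (suc i)))

nth-≥length : (xs : List A) (i : ℕ) → length xs ≤ i → nth xs i ≡ nothing
nth-≥length []       i       _         = refl
nth-≥length (x ∷ xs) (suc i) (s≤s le) = nth-≥length xs i le

nth-++ˡ : (xs ys : List A) (i : ℕ) → i < length xs → nth (xs ++ ys) i ≡ nth xs i
nth-++ˡ (x ∷ xs) ys zero    _        = refl
nth-++ˡ (x ∷ xs) ys (suc i) (s≤s lt) = nth-++ˡ xs ys i lt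

nth-++ʳ : (xs ys : List A) (i : ℕ) → nth (xs ++ ys) (length xs + i) ≡ nth ys i
nth-++ʳ []       ys i = refl
nth-++ʳ (x ∷ xs) ys i = nth-++ʳ xs ys i

nth-take : (xs : List A) (j i : ℕ) → i < j → nth (take j xs) i ≡ nth xs i
nth-take []       (suc j) i       _        = refl
nth-take (x ∷ xs) (suc j) zero    _        = refl
nth-take (x ∷ xs) (suc j) (suc i) (s≤s lt) = nth-take xs j i lt

nth-take-≥ : (xs : List A) (j i : ℕ) → j ≤ i → nth (take j xs) i ≡ nothing
nth-take-≥ xs j i le =
  nth-≥length (take j xs) i (≤-trans (≤-reflexive (length-take j xs)) (≤-trans (m⊓n≤m j (length xs)) le))

nth-drop : (xs : List A) (j i : ℕ) → nth (drop j xs) i ≡ nth xs (j + i)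
nth-drop xs       zero    i = refl
nth-drop []       (suc j) i = refl
nth-drop (x ∷ xs) (suc j) i = nth-drop xs j i

m<n∸o⇒o+m<n : ∀ {m n} o → m < n ∸ o → o + m < n
m<n∸o⇒o+m<n {m} {n} o lt =
  subst (_≤ n) (cong suc (+-comm m o))
    (m≤o∸n⇒m+n≤o (suc m) (<⇒≤ (m∸n≢0⇒n<m (λ eq → n≮0 (subst (m <_) eq lt)))) lt)

HasPeriod : List A → ℕ → Set
HasPeriod x e = ∀ i → i + e < length x → nth x i ≡ nth x (i + e)

HasPeriod-take : (x : List A) {e : ℕ} (j : ℕ) → HasPeriod x e → HasPeriod (take j x) e
HasPeriod-take x {e} j per i lt =
  trans (nth-take x j i (≤-<-trans (m≤m+n i e) i+e<j))
        (trans (per i i+e<x) (sym (nth-take x j (i + e) i+e<j)))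
  where
    lt′ : i + e < j ⊓ length x
    lt′ = subst (i + e <_) (length-take j x) lt
    i+e<j = m<n⊓o⇒m<n j (length x) lt′
    i+e<x = m<n⊓o⇒m<o j (length x) lt′

HasPeriod-drop : (x : List A) {e : ℕ} (j : ℕ) → HasPeriod x e → HasPeriod (drop j x) e
HasPeriod-drop x {e} j per i lt =
  trans (nth-drop x j i)
        (trans (per (j + i) j+i+e<x)
               (trans (cong (nth x) (+-assoc j i e)) (sym (nth-drop x j (i + e)))))
  where
    j+i+e<x : j + i + e < length x
    j+i+e<x = subst (_< length x) (sym (+-assoc j i e))
                (m<n∸o⇒o+m<n j (subst (i + e <_) (length-drop j x) lt))

HasPeriod-prepend : (u y : List A) → HasPeriod y (length u) →
  (∀ i → i < length u → i < length y → nth y i ≡ nth u i) → HasPeriod (u ++ y) (length u)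
HasPeriod-prepend u y per agree i lt with i <? length u
... | yes i<u = begin
  nth (u ++ y) i              ≡⟨ nth-++ˡ u y i i<u ⟩
  nth u i                     ≡⟨ agree i i<u i<y ⟨
  nth y i                     ≡⟨ nth-++ʳ u y i ⟨
  nth (u ++ y) (length u + i) ≡⟨ cong (nth (u ++ y)) (+-comm (length u) i) ⟩
  nth (u ++ y) (i + length u) ∎
  where
    open ≡-Reasoning
    i<y : i < length y
    i<y = +-cancelʳ-< (length u) i (length y)
            (subst (i + length u <_) (trans (length-++ u) (+-comm (length u) (length y))) lt)
... | no i≮u = begin
  nth (u ++ y) i                      ≡⟨ cong (nth (u ++ y)) u+i′≡i ⟨
  nth (u ++ y) (length u + i′)        ≡⟨ nth-++ʳ u y i′ ⟩
  nth y i′                            ≡⟨ per i′ i′+u<y ⟩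
  nth y (i′ + length u)               ≡⟨ nth-++ʳ u y (i′ + length u) ⟨
  nth (u ++ y) (length u + (i′ + length u)) ≡⟨ cong (nth (u ++ y)) (trans (sym (+-assoc (length u) i′ _)) (cong (_+ length u) u+i′≡i)) ⟩
  nth (u ++ y) (i + length u)         ∎
  where
    open ≡-Reasoning
    i′ = i ∸ length u
    u+i′≡i : length u + i′ ≡ i
    u+i′≡i = m+[n∸m]≡n (≮⇒≥ i≮u)
    i′+u<y : i′ + length u < length y
    i′+u<y = +-cancelˡ-< (length u) (i′ + length u) (length y)
      (subst₂ _<_ (trans (cong (_+ length u) (sym u+i′≡i)) (+-assoc (length u) i′ (length u))) (length-++ u) lt)

nth-^ʷ-++-take : (u : Word n) (m k i : ℕ) → i < length u → i < length (u ^ʷ m ++ take k u) →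
  nth (u ^ʷ m ++ take k u) i ≡ nth u i
nth-^ʷ-++-take u zero    k i _    lt = nth-take u k i (m<n⊓o⇒m<n k (length u) (subst (i <_) (length-take k u) lt))
nth-^ʷ-++-take u (suc m) k i i<u  _  =
  trans (cong (λ z → nth z i) (++-assoc u (u ^ʷ m) (take k u))) (nth-++ˡ u _ i i<u)

HasPeriod-^ʷ-++-take : (u : Word n) (m k : ℕ) → HasPeriod (u ^ʷ m ++ take k u) (length u)
HasPeriod-^ʷ-++-take u zero k i lt = ⊥-elim (<-irrefl refl (≤-trans (s≤s (m≤n+m (length u) i))
  (≤-trans lt (≤-trans (≤-reflexive (length-take k u)) (m⊓n≤n k (length u))))))
HasPeriod-^ʷ-++-take u (suc m) k = subst (λ z → HasPeriod z (length u)) (sym (++-assoc u (u ^ʷ m) (take k u)))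
  (HasPeriod-prepend u (u ^ʷ m ++ take k u) (HasPeriod-^ʷ-++-take u m k) (nth-^ʷ-++-take u m k))

HasPeriod-^ʷ : (u : Word n) (m : ℕ) → HasPeriod (u ^ʷ m) (length u)
HasPeriod-^ʷ u m = subst (λ z → HasPeriod z (length u)) (++-identityʳ (u ^ʷ m)) (HasPeriod-^ʷ-++-take u m 0)

length≡0⇒≡[] : (x : List A) → length x ≡ 0 → x ≡ []
length≡0⇒≡[] [] _ = refl

HasPeriod⇒≡^ʷ : (m : ℕ) (x : Word n) (e : ℕ) → HasPeriod x e → length x ≡ m * e → x ≡ take e x ^ʷ m
HasPeriod⇒≡^ʷ zero          x e per len = length≡0⇒≡[] x len
HasPeriod⇒≡^ʷ (suc zero)    x e per len =
  trans (sym (take++drop≡id e x)) (cong (take e x ++_) (length≡0⇒≡[] (drop e x)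
    (trans (length-drop e x) (trans (cong (_∸ e) (trans len (+-identityʳ e))) (n∸n≡0 e)))))
HasPeriod⇒≡^ʷ (suc (suc m)) x e per len =
  trans (sym (take++drop≡id e x))
        (cong (take e x ++_) (trans (HasPeriod⇒≡^ʷ (suc m) y e (HasPeriod-drop x e per) len-y)
                                    (cong (_^ʷ suc m) take-y≡take-x)))
  where
    y = drop e x
    len-y : length y ≡ suc m * e
    len-y = trans (length-drop e x) (trans (cong (_∸ e) len) (m+n∸m≡n e (suc m * e)))
    take-y≡take-x : take e y ≡ take e x
    take-y≡take-x = nth-ext (take e y) (take e x) same
      where
        same : ∀ i → nth (take e y) i ≡ nth (take e x) i
        same i with i <? e
        ... | no i≮e = trans (nth-take-≥ y e i (≮⇒≥ i≮e)) (sym (nth-take-≥ x e i (≮⇒≥ i≮e)))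
        ... | yes i<e = begin
          nth (take e y) i ≡⟨ nth-take y e i i<e ⟩
          nth y i          ≡⟨ nth-drop x e i ⟩
          nth x (e + i)    ≡⟨ cong (nth x) (+-comm e i) ⟩
          nth x (i + e)    ≡⟨ per i i+e<x ⟨
          nth x i          ≡⟨ nth-take x e i i<e ⟨
          nth (take e x) i ∎
          where
            open ≡-Reasoning
            i+e<x : i + e < length x
            i+e<x = subst (i + e <_) (trans (+-comm (e + m * e) e) (sym len))
                      (+-monoˡ-< e (<-≤-trans i<e (m≤m+n e (m * e))))

HasPeriod-∸ : (x : List A) (a c : ℕ) → HasPeriod x a → HasPeriod x (a + c) → a + (a + c) ≤ length x → HasPeriod x c
HasPeriod-∸ x a c pa pac len i lt with i + (a + c) <? length x
... | yes i+a+c<x = trans (pac i i+a+c<x) (sym (trans (pa (i + c) i+c+a<x) (cong (nth x) i+c+a≡i+a+c)))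
  where
    i+c+a≡i+a+c : i + c + a ≡ i + (a + c)
    i+c+a≡i+a+c = trans (+-assoc i c a) (cong (i +_) (+-comm c a))
    i+c+a<x = subst (_< length x) (sym i+c+a≡i+a+c) i+a+c<x
... | no i+a+c≮x = begin
  nth x i             ≡⟨ cong (nth x) i′+a≡i ⟨
  nth x (i′ + a)      ≡⟨ pa i′ (subst (_< length x) (sym i′+a≡i) (≤-<-trans (m≤m+n i c) lt)) ⟨
  nth x i′            ≡⟨ pac i′ (subst (_< length x) (sym i′+a+c≡i+c) lt) ⟩
  nth x (i′ + (a + c)) ≡⟨ cong (nth x) i′+a+c≡i+c ⟩
  nth x (i + c)       ∎
  where
    open ≡-Reasoning
    a≤i : a ≤ i
    a≤i = +-cancelʳ-≤ (a + c) a i (≤-trans len (≮⇒≥ i+a+c≮x))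
    i′ = i ∸ a
    i′+a≡i : i′ + a ≡ i
    i′+a≡i = m∸n+n≡m a≤i
    i′+a+c≡i+c : i′ + (a + c) ≡ i + c
    i′+a+c≡i+c = trans (sym (+-assoc i′ a c)) (cong (_+ c) i′+a≡i)

private
  CommonPeriod : List A → ℕ → ℕ → Set
  CommonPeriod x a b = ∃[ g ] 1 ≤ g × g ∣ a × g ∣ b × HasPeriod x g

  swap-CommonPeriod : {x : List A} {a b : ℕ} → CommonPeriod x a b → CommonPeriod x b a
  swap-CommonPeriod (g , 1≤g , g∣a , g∣b , per) = g , 1≤g , g∣b , g∣a , per

  -- Euclid's algorithm by subtraction (HasPeriod-∸); the fuel f bounds a + b.
  euclid : (x : List A) (f : ℕ) {a b : ℕ} → a + b ≤ f → HasPeriod x a → HasPeriod x b →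
    1 ≤ a → 1 ≤ b → a + b ≤ length x → CommonPeriod x a b
  euclid-< : (x : List A) (f : ℕ) {a b : ℕ} → a + b ≤ suc f → a < b → HasPeriod x a → HasPeriod x b →
    1 ≤ a → a + b ≤ length x → CommonPeriod x a b

  euclid x zero    {suc a} () pa pb 1≤a 1≤b len
  euclid x (suc f) {a} {b} fuel pa pb 1≤a 1≤b len with <-cmp a b
  ... | tri≈ _ refl _ = a , 1≤a , ∣-refl , ∣-refl , pa
  ... | tri< a<b _ _ = euclid-< x f fuel a<b pa pb 1≤a len
  ... | tri> _ _ b<a = swap-CommonPeriod {x = x}
    (euclid-< x f (subst (_≤ suc f) (+-comm a b) fuel) b<a pb pa 1≤b (subst (_≤ length x) (+-comm a b) len))

  euclid-< x f {a} {b} fuel a<b pa pb 1≤a len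
    with euclid x f {a} {c} fuel′ pa pc 1≤a (m<n⇒0<n∸m a<b) (≤-trans (≤-reflexive a+c≡b) (≤-trans (m≤n+m b a) len))
    where
      c = b ∸ a
      a+c≡b : a + c ≡ b
      a+c≡b = m+[n∸m]≡n (<⇒≤ a<b)
      pc = HasPeriod-∸ x a c pa (subst (HasPeriod x) (sym a+c≡b) pb) (subst (λ z → a + z ≤ length x) (sym a+c≡b) len)
      fuel′ : a + c ≤ f
      fuel′ = subst (_≤ f) (sym a+c≡b) (≤-pred (≤-trans (+-monoˡ-≤ b 1≤a) fuel))
  ... | g , 1≤g , g∣a , g∣c , per = g , 1≤g , g∣a , subst (g ∣_) (m+[n∸m]≡n (<⇒≤ a<b)) (∣m∣n⇒∣m+n g∣a g∣c) , per

-- Fine–Wilf in the weak form a + b ≤ |x| (instead of a + b - gcd a b ≤ |x|).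
fine-wilf : (x : List A) {a b : ℕ} → HasPeriod x a → HasPeriod x b → 1 ≤ a → 1 ≤ b → a + b ≤ length x →
  ∃[ g ] 1 ≤ g × g ∣ a × g ∣ b × HasPeriod x g
fine-wilf x {a} {b} = euclid x (a + b) ≤-refl

-- Primitive words

Primitive⇒1≤length : {w : Word n} → Primitive w → 1 ≤ length w
Primitive⇒1≤length {w = []}    (w≢[] , _) = ⊥-elim (w≢[] refl)
Primitive⇒1≤length {w = _ ∷ _} _          = s≤s z≤n

HasPeriod⇒¬Primitive : (w : Word n) {g : ℕ} → HasPeriod w g → g ∣ length w → g ≢ length w → ¬ Primitive w
HasPeriod⇒¬Primitive w {g} per (divides k len) g≢len prim@(_ , only-trivial) with k
... | zero          = <⇒≢ (Primitive⇒1≤length prim) (sym len)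
... | suc zero      = g≢len (sym (trans len (+-identityʳ g)))
... | suc (suc k′) with () ← only-trivial (take g w) (suc (suc k′)) (s≤s z≤n) (HasPeriod⇒≡^ʷ (suc (suc k′)) w g per len)

primitive-factor-divides-period : (x w : Word n) (j : ℕ) {e : ℕ} → Primitive w → take (length w) (drop j x) ≡ w →
  HasPeriod x (length w) → HasPeriod x e → 1 ≤ e → length w + e ≤ length x → length w ∣ e
primitive-factor-divides-period x w j prim factor per-w per-e 1≤e len
  with fine-wilf x per-w per-e (Primitive⇒1≤length prim) 1≤e len
... | g , _ , g∣w , g∣e , per-g with g ≟ length w
...   | yes refl = g∣e
...   | no g≢w   = ⊥-elim (HasPeriod⇒¬Primitive w per-g-w g∣w g≢w prim)
  where
    per-g-w : HasPeriod w g
    per-g-w = subst (λ z → HasPeriod z g) factor (HasPeriod-take (drop j x) (length w) (HasPeriod-drop x j per-g))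

+-≤-from-halves : ∀ {a b m} → 2 * a ≤ m → 2 * b ≤ m → a + b ≤ m
+-≤-from-halves {a} {b} {m} 2a≤m 2b≤m = *-cancelˡ-≤ 2
  (subst₂ _≤_ (sym (*-distribˡ-+ 2 a b)) (cong (m +_) (sym (+-identityʳ m))) (+-mono-≤ 2a≤m 2b≤m))

primitive-by-factor : (x w : Word n) (j : ℕ) → Primitive w → take (length w) (drop j x) ≡ w →
  HasPeriod x (length w) → 2 * length w ≤ length x → ¬ (length w ∣ length x) → Primitive x
primitive-by-factor x w j prim factor per-w 2w≤x w∤x = x≢[] , only-trivial
  where
    x≢[] : x ≢ []
    x≢[] refl = <⇒≱ (Primitive⇒1≤length prim) (m+n≤o⇒m≤o (length w) 2w≤x)
    only-trivial : ∀ v m → 1 ≤ m → x ≡ v ^ʷ m → m ≡ 1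
    only-trivial v (suc zero)     _ _   = refl
    only-trivial v m@(suc (suc _)) _ x≡v^m = ⊥-elim (w∤x (∣-trans w∣v (divides m x≡m*v)))
      where
        x≡m*v : length x ≡ m * length v
        x≡m*v = trans (cong length x≡v^m) (length-^ʷ v m)
        1≤v : 1 ≤ length v
        1≤v with length v | x≡m*v
        ... | zero  | len = ⊥-elim (x≢[] (length≡0⇒≡[] x (trans len (*-zeroʳ m))))
        ... | suc _ | _   = s≤s z≤n
        2v≤x : 2 * length v ≤ length x
        2v≤x = subst (2 * length v ≤_) (sym x≡m*v) (*-monoˡ-≤ (length v) {2} {m} (s≤s (s≤s z≤n)))
        w∣v : length w ∣ length v
        w∣v = primitive-factor-divides-period x w j prim factor per-w
                (subst (λ z → HasPeriod z (length v)) (sym x≡v^m) (HasPeriod-^ʷ v m)) 1≤v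
                (+-≤-from-halves {length w} {length v} 2w≤x 2v≤x)

-- Counting words

length-cartesianProductWith : {B C : Set} (f : A → B → C) (xs : List A) (ys : List B) →
  length (cartesianProductWith f xs ys) ≡ length xs * length ys
length-cartesianProductWith f []       ys = refl
length-cartesianProductWith f (x ∷ xs) ys =
  trans (length-++ (map (f x) ys)) (cong₂ _+_ (length-map (f x) ys) (length-cartesianProductWith f xs ys))

∈-++-∷⇒∈-++ : {x z : A} (ys zs : List A) → z ∈ ys ++ x ∷ zs → z ≢ x → z ∈ ys ++ zs
∈-++-∷⇒∈-++ []       zs (here refl) z≢x = ⊥-elim (z≢x refl)
∈-++-∷⇒∈-++ []       zs (there z∈)  z≢x = z∈
∈-++-∷⇒∈-++ (y ∷ ys) zs (here z≡y)  z≢x = here z≡y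
∈-++-∷⇒∈-++ (y ∷ ys) zs (there z∈)  z≢x = there (∈-++-∷⇒∈-++ ys zs z∈ z≢x)

Unique-⊆⇒length≤ : (xs ys : List A) → Unique xs → xs ⊆ ys → length xs ≤ length ys
Unique-⊆⇒length≤ []       ys _            _    = z≤n
Unique-⊆⇒length≤ (x ∷ xs) ys (x∉xs ∷ uxs) x∷xs⊆ys with ∈-∃++ (x∷xs⊆ys (here refl))
... | ys₁ , ys₂ , refl = subst (suc (length xs) ≤_) (sym length-ys) (s≤s
      (Unique-⊆⇒length≤ xs (ys₁ ++ ys₂) uxs (λ z∈ → ∈-++-∷⇒∈-++ ys₁ ys₂ (x∷xs⊆ys (there z∈)) (z≢x z∈))))
  where
    z≢x : ∀ {z} → z ∈ xs → z ≢ x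
    z≢x z∈ refl = All.lookup x∉xs z∈ refl
    length-ys : length (ys₁ ++ x ∷ ys₂) ≡ suc (length (ys₁ ++ ys₂))
    length-ys = trans (length-++ ys₁) (trans (+-suc (length ys₁) (length ys₂)) (cong suc (sym (length-++ ys₁))))

length-filter+filter-∁ : {P : A → Set} (P? : Decidable P) (xs : List A) →
  length (filter P? xs) + length (filter (∁? P?) xs) ≡ length xs
length-filter+filter-∁ P? []       = refl
length-filter+filter-∁ P? (x ∷ xs) with P? x
... | yes _ = cong suc (length-filter+filter-∁ P? xs)
... | no  _ = trans (+-suc _ _) (cong suc (length-filter+filter-∁ P? xs))

map-Unique : {B : Set} (f : A → B) (xs : List A) → Unique xs →
  (∀ {x y} → x ∈ xs → y ∈ xs → f x ≡ f y → x ≡ y) → Unique (map f xs)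
map-Unique f []       _            _   = []
map-Unique f (x ∷ xs) (x∉xs ∷ uxs) inj =
  All.tabulate (λ fy∈ fx≡fy → let (y , y∈ , fy≡) = ∈-map⁻ f fy∈
                              in All.lookup x∉xs y∈ (inj (here refl) (there y∈) (trans fx≡fy fy≡)))
  ∷ map-Unique f xs uxs (λ x∈ y∈ → inj (there x∈) (there y∈))

words : ℕ → List (Word n)
words zero    = [] ∷ []
words (suc L) = cartesianProductWith _∷_ (allFin _) (words L)

length-words : (L : ℕ) → length (words {n} L) ≡ n ^ L
length-words {n} zero    = refl
length-words {n} (suc L) = trans (length-cartesianProductWith _∷_ (allFin n) (words L))
  (cong₂ _*_ (length-tabulate {n = n} (λ i → i)) (length-words L))

∈-words : (w : Word n) → w ∈ words (length w)
∈-words []      = here refl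
∈-words (a ∷ w) = ∈-cartesianProductWith⁺ _∷_ (∈-allFin a) (∈-words w)

∈-words-of-length : {L : ℕ} {w : Word n} → length w ≡ L → w ∈ words L
∈-words-of-length {w = w} refl = ∈-words w

∈-words⇒length : (L : ℕ) {w : Word n} → w ∈ words L → length w ≡ L
∈-words⇒length zero    (here refl) = refl
∈-words⇒length {n} (suc L) w∈ with ∈-cartesianProductWith⁻ _∷_ (allFin n) (words L) w∈
... | _ , v , _ , v∈ , refl = cong suc (∈-words⇒length L v∈)

words-unique : (L : ℕ) → Unique (words {n} L)
words-unique zero    = All.[] ∷ []
words-unique {n} (suc L) = UniqueP.cartesianProductWith⁺ _∷_ ∷-injective′ (UniqueP.allFin⁺ n) (words-unique L)
  where
    ∷-injective′ : {a b : Fin n} {u v : Word n} → a ∷ u ≡ b ∷ v → a ≡ b × u ≡ v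
    ∷-injective′ refl = refl , refl

-- All v ^ʷ (L / e) with 1 ≤ |v| = e ≤ h.  For h = ⌊ L /2⌋ this contains every proper power of length L,
-- together with some words of other lengths (when e ∤ L).
powersUpTo : ℕ → ℕ → List (Word n)
powersUpTo L zero    = []
powersUpTo L (suc e) = map (_^ʷ (L / suc e)) (words (suc e)) ++ powersUpTo L e

properPowers : ℕ → List (Word n)
properPowers L = powersUpTo L ⌊ L /2⌋

∈-powersUpTo : (L h e : ℕ) (v : Word n) → suc e ≤ h → length v ≡ suc e → v ^ʷ (L / suc e) ∈ powersUpTo L h
∈-powersUpTo L (suc h) e v e<h len-v with suc e ≟ suc h
... | yes refl = ∈-++⁺ˡ (∈-map⁺ (_^ʷ (L / suc e)) (subst (λ k → v ∈ words k) len-v (∈-words v)))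
... | no  e≢h  = ∈-++⁺ʳ _ (∈-powersUpTo L h e v (≤-pred (≤∧≢⇒< e<h e≢h)) len-v)

≤⌊/2⌋ : ∀ {k L} → 2 * k ≤ L → k ≤ ⌊ L /2⌋
≤⌊/2⌋ {k} {L} 2k≤L = subst (_≤ ⌊ L /2⌋) (sym (n≡⌊n+n/2⌋ k)) (⌊n/2⌋-mono (subst (_≤ L) (cong (k +_) (+-identityʳ k)) 2k≤L))

^ʷ∈properPowers : (v : Word n) (m : ℕ) → 2 ≤ m → 1 ≤ length v → v ^ʷ m ∈ properPowers (length (v ^ʷ m))
^ʷ∈properPowers v m 2≤m 1≤v with length v in len-v
... | suc e = subst (λ z → v ^ʷ z ∈ properPowers L) L/e≡m (∈-powersUpTo L ⌊ L /2⌋ e v (≤⌊/2⌋ 2e≤L) len-v)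
  where
    L = length (v ^ʷ m)
    L≡m*e : L ≡ m * suc e
    L≡m*e = trans (length-^ʷ v m) (cong (m *_) len-v)
    L/e≡m : L / suc e ≡ m
    L/e≡m = trans (cong (_/ suc e) L≡m*e) (m*n/n≡m m (suc e))
    2e≤L : 2 * suc e ≤ L
    2e≤L = subst (2 * suc e ≤_) (sym L≡m*e) (*-monoˡ-≤ (suc e) 2≤m)

∉properPowers⇒Primitive : (w : Word n) → 1 ≤ length w → w ∉ properPowers (length w) → Primitive w
∉properPowers⇒Primitive w 1≤w w∉ = w≢[] , only-trivial
  where
    w≢[] : w ≢ []
    w≢[] refl = <⇒≱ 1≤w z≤n
    only-trivial : ∀ v m → 1 ≤ m → w ≡ v ^ʷ m → m ≡ 1
    only-trivial v (suc zero)       _ _ = refl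
    only-trivial []      m@(suc (suc _)) _ w≡ = ⊥-elim (w≢[] (trans w≡ (length≡0⇒≡[] ([] ^ʷ m) (trans (length-^ʷ [] m) (*-zeroʳ m)))))
    only-trivial (a ∷ u) m@(suc (suc _)) _ refl = ⊥-elim (w∉ (^ʷ∈properPowers (a ∷ u) m (s≤s (s≤s z≤n)) (s≤s z≤n)))

length-powersUpTo : 2 ≤ n → (L h : ℕ) → length (powersUpTo {n} L h) ≤ 2 * n ^ h
length-powersUpTo         2≤n L zero    = z≤n
length-powersUpTo {n = n} 2≤n L (suc h) = begin
  length (map (_^ʷ (L / suc h)) ws ++ ps)          ≡⟨ length-++ (map (_^ʷ (L / suc h)) ws) ⟩
  length (map (_^ʷ (L / suc h)) ws) + length ps    ≡⟨ cong (_+ length ps) (trans (length-map _ ws) (length-words {n} (suc h))) ⟩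
  n ^ suc h + length ps                            ≤⟨ +-monoʳ-≤ (n ^ suc h) (length-powersUpTo 2≤n L h) ⟩
  n ^ suc h + 2 * n ^ h                            ≤⟨ +-monoʳ-≤ (n ^ suc h) (*-monoˡ-≤ (n ^ h) 2≤n) ⟩
  n ^ suc h + n ^ suc h                            ≡⟨ cong (n ^ suc h +_) (sym (+-identityʳ (n ^ suc h))) ⟩
  2 * n ^ suc h                                    ∎
  where
    open ≤-Reasoning
    ws = words {n} (suc h)
    ps = powersUpTo {n} L h

_∈?properPowers_ : (w : Word n) (L : ℕ) → Dec (w ∈ properPowers L)
w ∈?properPowers L = ∈-dec (≡-dec Fin._≟_) w (properPowers L)

primitiveWords : ℕ → List (Word n)
primitiveWords L = filter (∁? (_∈?properPowers L)) (words L)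

primitiveWords-unique : (L : ℕ) → Unique (primitiveWords {n} L)
primitiveWords-unique L = UniqueP.filter⁺ _ (words-unique L)

∈-primitiveWords⁻ : (L : ℕ) {w : Word n} → 1 ≤ L → w ∈ primitiveWords L → length w ≡ L × Primitive w
∈-primitiveWords⁻ L {w} 1≤L w∈ with ∈-filter⁻ (∁? (_∈?properPowers L)) {xs = words L} w∈
... | w∈words , w∉ = len , ∉properPowers⇒Primitive w (subst (1 ≤_) (sym len) 1≤L) (subst (λ k → w ∉ properPowers k) (sym len) w∉)
  where len = ∈-words⇒length L w∈words

length-primitiveWords : 2 ≤ n → (L : ℕ) → n ^ L ≤ length (primitiveWords {n} L) + 2 * n ^ ⌊ L /2⌋
length-primitiveWords {n} 2≤n L = begin
  n ^ L                                       ≡⟨ length-words L ⟨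
  length (words L)                            ≡⟨ length-filter+filter-∁ P? (words L) ⟨
  length (filter P? (words L)) + length (primitiveWords L)
    ≤⟨ +-monoˡ-≤ _ (Unique-⊆⇒length≤ _ (properPowers L) (UniqueP.filter⁺ P? (words-unique L)) (λ w∈ → proj₂ (∈-filter⁻ P? {xs = words L} w∈))) ⟩
  length (properPowers {n} L) + length (primitiveWords L)
    ≤⟨ +-monoˡ-≤ _ (length-powersUpTo 2≤n L ⌊ L /2⌋) ⟩
  2 * n ^ ⌊ L /2⌋ + length (primitiveWords L) ≡⟨ +-comm _ (length (primitiveWords L)) ⟩
  length (primitiveWords L) + 2 * n ^ ⌊ L /2⌋ ∎
  where
    open ≤-Reasoning
    P? = _∈?properPowers L

-- The pairs counted by ε₂

conjugatePair : (α β : Word n) (r s : ℕ) → Word n × Word n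
conjugatePair α β r s = (β ++ α) ^ʷ r ++ β , (α ++ β) ^ʷ s ++ α

-- The pair with parameters d = c + 3 s and |w| = 3 t, cut as w = α β with |α| = t if c = 1 and
-- |α| = 2 t otherwise (c = 0 does not occur for the pairs of ε₂).
pairFor : (c s t : ℕ) → Word n → Word n × Word n
pairFor (suc zero) s t w = conjugatePair (take t w) (drop t w) (2 * s) s
pairFor _          s t w = conjugatePair (take (2 * t) w) (drop (2 * t) w) (2 * s + 1) s

pair : (d t : ℕ) → Word n → Word n × Word n
pair d t w = pairFor (d % 3) (d / 3) t w

length-^ʷ-++ : (α β : Word n) (s : ℕ) → length ((α ++ β) ^ʷ s ++ α) ≡ s * (length α + length β) + length α
length-^ʷ-++ α β s = trans (length-++ ((α ++ β) ^ʷ s)) (cong (_+ length α) (trans (length-^ʷ (α ++ β) s) (cong (s *_) (length-++ α))))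

[c+s*3]/3≡s : ∀ c s → c < 3 → (c + s * 3) / 3 ≡ s
[c+s*3]/3≡s c s c<3 = trans (+-distrib-/ c (s * 3) c%3+s*3%3<3) (cong₂ _+_ (m<n⇒m/n≡0 c<3) (m*n/n≡m s 3))
  where
    c%3+s*3%3<3 : c % 3 + s * 3 % 3 < 3
    c%3+s*3%3<3 = subst (_< 3) (sym (cong₂ _+_ (m<n⇒m%n≡m c<3) (m*n%n≡0 s 3))) (subst (_< 3) (sym (+-identityʳ c)) c<3)

[c+s*3]%3≡c : ∀ c s → c < 3 → (c + s * 3) % 3 ≡ c
[c+s*3]%3≡c c s c<3 = trans ([m+kn]%n≡m%n c s 3) (m<n⇒m%n≡m c<3)

Eps2Pair⇒≡pair : {l : ℕ} {p q : Word n} → Eps2Pair n l (p , q) →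
  ∃[ d ] ∃[ t ] ∃[ w ] l ≡ d * t × 4 ≤ d × length w ≡ 3 * t × (p , q) ≡ pair d t w
Eps2Pair⇒≡pair (_ , _ , _ , len-q , _ , α , β , s , _ , _ , 1≤s , _ , refl , inj₁ (refl , β≡2α)) =
  d , t , α ++ β , l≡d*t , s≤s (*-monoˡ-≤ 3 1≤s) , len-w , sym (begin
    pairFor (d % 3) (d / 3) t (α ++ β) ≡⟨ cong₂ (λ c s′ → pairFor c s′ t (α ++ β)) ([c+s*3]%3≡c 1 s 1<3) ([c+s*3]/3≡s 1 s 1<3) ⟩
    conjugatePair (take t (α ++ β)) (drop t (α ++ β)) (2 * s) s ≡⟨ cong₂ (λ α′ β′ → conjugatePair α′ β′ (2 * s) s) (take-length-++ α β) (drop-length-++ α β) ⟩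
    conjugatePair α β (2 * s) s ∎)
  where
    open ≡-Reasoning
    t = length α
    d = 1 + s * 3
    1<3 : 1 < 3
    1<3 = s≤s (s≤s z≤n)
    len-w : length (α ++ β) ≡ 3 * t
    len-w = trans (length-++ α) (trans (cong (t +_) β≡2α) (t+2t≡3t t))
      where t+2t≡3t : ∀ t → t + 2 * t ≡ 3 * t
            t+2t≡3t = solve-∀
    l≡d*t : _ ≡ d * t
    l≡d*t = trans (sym len-q) (trans (length-^ʷ-++ α β s) (trans (cong (λ b → s * (t + b) + t) β≡2α) (arith s t)))
      where arith : ∀ s t → s * (t + 2 * t) + t ≡ (1 + s * 3) * t
            arith = solve-∀
Eps2Pair⇒≡pair (_ , _ , _ , len-q , _ , α , β , s , _ , _ , 1≤s , _ , refl , inj₂ (refl , α≡2β)) =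
  d , t , α ++ β , l≡d*t , s≤s (s≤s (≤-trans (s≤s (s≤s z≤n)) (*-monoˡ-≤ 3 1≤s))) , len-w , sym (begin
    pairFor (d % 3) (d / 3) t (α ++ β) ≡⟨ cong₂ (λ c s′ → pairFor c s′ t (α ++ β)) ([c+s*3]%3≡c 2 s 2<3) ([c+s*3]/3≡s 2 s 2<3) ⟩
    conjugatePair (take (2 * t) (α ++ β)) (drop (2 * t) (α ++ β)) (2 * s + 1) s
      ≡⟨ cong₂ (λ α′ β′ → conjugatePair α′ β′ (2 * s + 1) s)
               (subst (λ j → take j (α ++ β) ≡ α) α≡2β (take-length-++ α β))
               (subst (λ j → drop j (α ++ β) ≡ β) α≡2β (drop-length-++ α β)) ⟩
    conjugatePair α β (2 * s + 1) s ∎)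
  where
    open ≡-Reasoning
    t = length β
    d = 2 + s * 3
    2<3 : 2 < 3
    2<3 = s≤s (s≤s (s≤s z≤n))
    len-w : length (α ++ β) ≡ 3 * t
    len-w = trans (length-++ α) (trans (cong (_+ t) α≡2β) (2t+t≡3t t))
      where 2t+t≡3t : ∀ t → 2 * t + t ≡ 3 * t
            2t+t≡3t = solve-∀
    l≡d*t : _ ≡ d * t
    l≡d*t = trans (sym len-q) (trans (length-^ʷ-++ α β s) (trans (cong (λ a → s * (a + t) + a) α≡2β) (arith s t)))
      where arith : ∀ s t → s * (2 * t + t) + 2 * t ≡ (2 + s * 3) * t
            arith = solve-∀

conjugate-second-primitive : (α β : Word n) (s : ℕ) → Primitive (α ++ β) → 1 ≤ s →
  let q = (α ++ β) ^ʷ s ++ α in 2 * length (α ++ β) ≤ length q → ¬ (length (α ++ β) ∣ length q) → Primitive q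
conjugate-second-primitive α β s prim 1≤s = primitive-by-factor _ (α ++ β) 0 prim (take-length-^ʷ (α ++ β) α s 1≤s)
  (subst (λ z → HasPeriod ((α ++ β) ^ʷ s ++ z) (length (α ++ β))) (take-length-++ α β) (HasPeriod-^ʷ-++-take (α ++ β) s (length α)))

conjugate-first-primitive : (α β : Word n) (r : ℕ) → Primitive (α ++ β) → 1 ≤ r →
  let p = (β ++ α) ^ʷ r ++ β in 2 * length (α ++ β) ≤ length p → ¬ (length (α ++ β) ∣ length p) → Primitive p
conjugate-first-primitive α β r prim 1≤r = primitive-by-factor p w (length β) prim factor per
  where
    w = α ++ β
    p = (β ++ α) ^ʷ r ++ β
    factor : take (length w) (drop (length β) p) ≡ w
    factor = begin
      take (length w) (drop (length β) p)               ≡⟨ cong (λ z → take (length w) (drop (length β) z)) (++-^ʷ-conjugate α β r) ⟨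
      take (length w) (drop (length β) (β ++ w ^ʷ r))   ≡⟨ cong (take (length w)) (drop-length-++ β (w ^ʷ r)) ⟩
      take (length w) (w ^ʷ r)                          ≡⟨ cong (take (length w)) (++-identityʳ (w ^ʷ r)) ⟨
      take (length w) (w ^ʷ r ++ [])                    ≡⟨ take-length-^ʷ w [] r 1≤r ⟩
      w                                                 ∎
      where open ≡-Reasoning
    per : HasPeriod p (length w)
    per = subst₂ (λ z e → HasPeriod ((β ++ α) ^ʷ r ++ z) e) (take-length-++ β α) (length-++-comm β α)
            (HasPeriod-^ʷ-++-take (β ++ α) r (length β))

conjugatePair-++-not-primitive : (α β : Word n) (r s : ℕ) → 1 ≤ r →
  ¬ Primitive (((β ++ α) ^ʷ r ++ β) ++ ((α ++ β) ^ʷ s ++ α))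
conjugatePair-++-not-primitive α β r s 1≤r (_ , only-trivial) =
  <⇒≢ (+-mono-≤ 1≤r (m≤n+m 1 s)) (sym (only-trivial (β ++ α) (r + (s + 1)) (≤-trans 1≤r (m≤m+n r _)) p++q≡))
  where
    u = β ++ α
    p++q≡ : ((u ^ʷ r ++ β) ++ ((α ++ β) ^ʷ s ++ α)) ≡ u ^ʷ (r + (s + 1))
    p++q≡ = begin
      (u ^ʷ r ++ β) ++ ((α ++ β) ^ʷ s ++ α)  ≡⟨ ++-assoc (u ^ʷ r) β _ ⟩
      u ^ʷ r ++ (β ++ ((α ++ β) ^ʷ s ++ α))  ≡⟨ cong (u ^ʷ r ++_) (++-assoc β _ α) ⟨
      u ^ʷ r ++ ((β ++ (α ++ β) ^ʷ s) ++ α)  ≡⟨ cong (λ z → u ^ʷ r ++ (z ++ α)) (++-^ʷ-conjugate α β s) ⟩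
      u ^ʷ r ++ ((u ^ʷ s ++ β) ++ α)         ≡⟨ cong (u ^ʷ r ++_) (++-assoc (u ^ʷ s) β α) ⟩
      u ^ʷ r ++ (u ^ʷ s ++ u)                ≡⟨ cong (λ z → u ^ʷ r ++ (u ^ʷ s ++ z)) (++-identityʳ u) ⟨
      u ^ʷ r ++ (u ^ʷ s ++ u ^ʷ 1)           ≡⟨ cong (u ^ʷ r ++_) (^ʷ-+ u s 1) ⟩
      u ^ʷ r ++ u ^ʷ (s + 1)                 ≡⟨ ^ʷ-+ u r (s + 1) ⟩
      u ^ʷ (r + (s + 1))                     ∎
      where open ≡-Reasoning

ShortNonDivisor : ℕ → ℕ → Set
ShortNonDivisor m l = 2 * m ≤ l × ¬ (m ∣ l) × ¬ (m ∣ 2 * l)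

conjugatePair-Eps2Pair : {l r s : ℕ} (α β w : Word n) → α ++ β ≡ w → Primitive w → α ≢ [] → β ≢ [] → 1 ≤ r → 1 ≤ s →
  length ((β ++ α) ^ʷ r ++ β) ≡ 2 * l → length ((α ++ β) ^ʷ s ++ α) ≡ l → ShortNonDivisor (length w) l →
  (r ≡ 2 * s × length β ≡ 2 * length α) ⊎ (r ≡ 2 * s + 1 × length α ≡ 2 * length β) →
  Eps2Pair n l (conjugatePair α β r s)
conjugatePair-Eps2Pair {l = l} {r} {s} α β _ refl prim α≢[] β≢[] 1≤r 1≤s len-p len-q (2w≤l , w∤l , w∤2l) shape =
  conjugate-first-primitive α β r prim 1≤r (subst (2 * length (α ++ β) ≤_) (sym len-p) (≤-trans 2w≤l (m≤n*m l 2)))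
    (subst (λ k → ¬ (length (α ++ β) ∣ k)) (sym len-p) w∤2l) ,
  conjugate-second-primitive α β s prim 1≤s (subst (2 * length (α ++ β) ≤_) (sym len-q) 2w≤l)
    (subst (λ k → ¬ (length (α ++ β) ∣ k)) (sym len-q) w∤l) ,
  len-p , len-q , conjugatePair-++-not-primitive α β r s 1≤r ,
  α , β , s , α≢[] , β≢[] , 1≤s , prim , refl ,
  Sum.map (Product.map₁ (cong (λ k → (β ++ α) ^ʷ k ++ β))) (Product.map₁ (cong (λ k → (β ++ α) ^ʷ k ++ β))) shape

length-take-drop : (w : List A) (j k : ℕ) → length w ≡ j + k → length (take j w) ≡ j × length (drop j w) ≡ k
length-take-drop w j k len =
  trans (length-take j w) (m≤n⇒m⊓n≡m (subst (j ≤_) (sym len) (m≤m+n j k))) ,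
  trans (length-drop j w) (trans (cong (_∸ j) len) (m+n∸m≡n j k))

1≤length⇒≢[] : {x : List A} → 1 ≤ length x → x ≢ []
1≤length⇒≢[] 1≤x refl = <⇒≱ 1≤x z≤n

pairFor-1-Eps2Pair : (s t : ℕ) (w : Word n) → Primitive w → length w ≡ 3 * t → 1 ≤ t → 1 ≤ s →
  ShortNonDivisor (length w) ((1 + s * 3) * t) → Eps2Pair n ((1 + s * 3) * t) (pairFor 1 s t w)
pairFor-1-Eps2Pair s t w prim len-w 1≤t 1≤s short =
  conjugatePair-Eps2Pair {s = s} α β w (take++drop≡id t w) prim (1≤length⇒≢[] (subst (1 ≤_) (sym len-α) 1≤t))
    (1≤length⇒≢[] (subst (1 ≤_) (sym len-β) (≤-trans 1≤t (m≤n*m t 2)))) (≤-trans 1≤s (m≤n*m s 2)) 1≤s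
    len-p len-q short (inj₁ (refl , trans len-β (cong (2 *_) (sym len-α))))
  where
    α = take t w
    β = drop t w
    len-αβ = length-take-drop w t (2 * t) (trans len-w (3t≡t+2t t))
      where 3t≡t+2t : ∀ t → 3 * t ≡ t + 2 * t
            3t≡t+2t = solve-∀
    len-α = proj₁ len-αβ
    len-β = proj₂ len-αβ
    len-q : length ((α ++ β) ^ʷ s ++ α) ≡ (1 + s * 3) * t
    len-q = trans (length-^ʷ-++ α β s) (trans (cong₂ (λ a b → s * (a + b) + a) len-α len-β) (arith s t))
      where arith : ∀ s t → s * (t + 2 * t) + t ≡ (1 + s * 3) * t
            arith = solve-∀
    len-p : length ((β ++ α) ^ʷ (2 * s) ++ β) ≡ 2 * ((1 + s * 3) * t)
    len-p = trans (length-^ʷ-++ β α (2 * s)) (trans (cong₂ (λ a b → 2 * s * (b + a) + b) len-α len-β) (arith s t))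
      where arith : ∀ s t → 2 * s * (2 * t + t) + 2 * t ≡ 2 * ((1 + s * 3) * t)
            arith = solve-∀

pairFor-2-Eps2Pair : (s t : ℕ) (w : Word n) → Primitive w → length w ≡ 3 * t → 1 ≤ t → 1 ≤ s →
  ShortNonDivisor (length w) ((2 + s * 3) * t) → Eps2Pair n ((2 + s * 3) * t) (pairFor 2 s t w)
pairFor-2-Eps2Pair s t w prim len-w 1≤t 1≤s short =
  conjugatePair-Eps2Pair {s = s} α β w (take++drop≡id (2 * t) w) prim
    (1≤length⇒≢[] (subst (1 ≤_) (sym len-α) (≤-trans 1≤t (m≤n*m t 2)))) (1≤length⇒≢[] (subst (1 ≤_) (sym len-β) 1≤t))
    (m≤n+m 1 (2 * s)) 1≤s len-p len-q short (inj₂ (refl , trans len-α (cong (2 *_) (sym len-β))))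
  where
    α = take (2 * t) w
    β = drop (2 * t) w
    len-αβ = length-take-drop w (2 * t) t (trans len-w (3t≡2t+t t))
      where 3t≡2t+t : ∀ t → 3 * t ≡ 2 * t + t
            3t≡2t+t = solve-∀
    len-α = proj₁ len-αβ
    len-β = proj₂ len-αβ
    len-q : length ((α ++ β) ^ʷ s ++ α) ≡ (2 + s * 3) * t
    len-q = trans (length-^ʷ-++ α β s) (trans (cong₂ (λ a b → s * (a + b) + a) len-α len-β) (arith s t))
      where arith : ∀ s t → s * (2 * t + t) + 2 * t ≡ (2 + s * 3) * t
            arith = solve-∀
    len-p : length ((β ++ α) ^ʷ (2 * s + 1) ++ β) ≡ 2 * ((2 + s * 3) * t)
    len-p = trans (length-^ʷ-++ β α (2 * s + 1)) (trans (cong₂ (λ a b → (2 * s + 1) * (b + a) + b) len-α len-β) (arith s t))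
      where arith : ∀ s t → (2 * s + 1) * (t + 2 * t) + t ≡ 2 * ((2 + s * 3) * t)
            arith = solve-∀

3-prime : Prime 3
3-prime = from-yes (prime? 3)

3∤2 : ¬ (3 ∣ 2)
3∤2 3∣2 with ∣⇒≤ 3∣2
... | s≤s (s≤s ())

6≤c+s*3⇒1≤s : ∀ {c s} → c < 3 → 6 ≤ c + s * 3 → 1 ≤ s
6≤c+s*3⇒1≤s {c} {zero}  c<3 6≤c = ⊥-elim (<⇒≱ (≤-trans c<3 (s≤s (s≤s (s≤s z≤n)))) (subst (6 ≤_) (+-identityʳ c) 6≤c))
6≤c+s*3⇒1≤s {c} {suc s} _   _   = s≤s z≤n

pair-Eps2Pair : (d t : ℕ) (w : Word n) → Primitive w → length w ≡ 3 * t → 1 ≤ t → 6 ≤ d → ¬ (3 ∣ d) →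
  Eps2Pair n (d * t) (pair d t w)
pair-Eps2Pair {n} d t w prim len-w 1≤t 6≤d 3∤d = by-residue (d % 3) (d / 3) (m≡m%n+[m/n]*n d 3) (m%n<n d 3)
  where
    cancel-t : ∀ {m} → length w ∣ m * t → 3 ∣ m
    cancel-t w∣mt = *-cancelʳ-∣ t {{>-nonZero 1≤t}} (subst (_∣ _) len-w w∣mt)
    short : ShortNonDivisor (length w) (d * t)
    short = subst (_≤ d * t) (trans (*-assoc 2 3 t) (cong (2 *_) (sym len-w))) (*-monoˡ-≤ t 6≤d) ,
            (λ w∣dt → 3∤d (cancel-t w∣dt)) ,
            (λ w∣2dt → [ 3∤2 , 3∤d ]′ (euclidsLemma 2 d 3-prime (cancel-t (subst (length w ∣_) (sym (*-assoc 2 d t)) w∣2dt))))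
    by-residue : ∀ c s → d ≡ c + s * 3 → c < 3 → Eps2Pair n (d * t) (pairFor c s t w)
    by-residue zero                s d≡s*3 _   = ⊥-elim (3∤d (divides s d≡s*3))
    by-residue (suc zero)          s refl  c<3 = pairFor-1-Eps2Pair s t w prim len-w 1≤t (6≤c+s*3⇒1≤s c<3 6≤d) short
    by-residue (suc (suc zero))    s refl  c<3 = pairFor-2-Eps2Pair s t w prim len-w 1≤t (6≤c+s*3⇒1≤s c<3 6≤d) short
    by-residue (suc (suc (suc _))) s _     (s≤s (s≤s (s≤s ())))

second-pairFor : (c s t : ℕ) (w : Word n) → ∃[ j ] proj₂ (pairFor c s t w) ≡ w ^ʷ s ++ take j w
second-pairFor zero          s t w = 2 * t , cong (λ z → z ^ʷ s ++ take (2 * t) w) (take++drop≡id (2 * t) w)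
second-pairFor (suc zero)    s t w = t     , cong (λ z → z ^ʷ s ++ take t w) (take++drop≡id t w)
second-pairFor (suc (suc c)) s t w = 2 * t , cong (λ z → z ^ʷ s ++ take (2 * t) w) (take++drop≡id (2 * t) w)

pair-prefix : (d t : ℕ) (w : Word n) → 3 ≤ d → take (length w) (proj₂ (pair d t w)) ≡ w
pair-prefix d t w 3≤d with second-pairFor (d % 3) (d / 3) t w
... | j , q≡ = trans (cong (take (length w)) q≡) (take-length-^ʷ w (take j w) (d / 3) (m≥n⇒m/n>0 3≤d))

pair-period : (d t : ℕ) (w : Word n) → HasPeriod (proj₂ (pair d t w)) (length w)
pair-period d t w with second-pairFor (d % 3) (d / 3) t w
... | j , q≡ = subst (λ z → HasPeriod z (length w)) (sym q≡) (HasPeriod-^ʷ-++-take w (d / 3) j)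

pair-injective : {d t : ℕ} (w w′ : Word n) → 3 ≤ d → length w ≡ length w′ → pair d t w ≡ pair d t w′ → w ≡ w′
pair-injective {d = d} {t} w w′ 3≤d len eq = begin
  w                                         ≡⟨ pair-prefix d t w 3≤d ⟨
  take (length w) (proj₂ (pair d t w))      ≡⟨ cong₂ (λ k x → take k (proj₂ x)) len eq ⟩
  take (length w′) (proj₂ (pair d t w′))    ≡⟨ pair-prefix d t w′ 3≤d ⟩
  w′                                        ∎
  where open ≡-Reasoning

pair-≡⇒∣ : {d t d′ t′ : ℕ} (w w′ : Word n) → pair d t w ≡ pair d′ t′ w′ → Primitive w → 3 ≤ d → 1 ≤ length w′ →
  length w + length w′ ≤ length (proj₂ (pair d t w)) → length w ∣ length w′
pair-≡⇒∣ {d = d} {t} {d′} {t′} w w′ eq prim 3≤d 1≤w′ =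
  primitive-factor-divides-period (proj₂ (pair d t w)) w 0 prim (pair-prefix d t w 3≤d) (pair-period d t w)
    (subst (λ x → HasPeriod (proj₂ x) (length w′)) (sym eq) (pair-period d′ t′ w′)) 1≤w′

-- ε₂(n, P Q) for primes 7 ≤ P < Q

∣-product-of-primes : {P Q t : ℕ} → Prime P → Prime Q → t ∣ P * Q → t ≡ 1 ⊎ t ≡ P ⊎ t ≡ Q ⊎ t ≡ P * Q
∣-product-of-primes {P} {Q} {t} P-prime Q-prime t∣PQ with P ∣? t
... | yes (divides k refl) with prime⇒irreducible Q-prime
      (*-cancelʳ-∣ {k} {Q} P {{prime⇒nonZero P-prime}} (subst (k * P ∣_) (*-comm P Q) t∣PQ))
...   | inj₁ refl = inj₂ (inj₁ (+-identityʳ P))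
...   | inj₂ refl = inj₂ (inj₂ (inj₂ (*-comm Q P)))
∣-product-of-primes {P} {Q} {t} P-prime Q-prime t∣PQ | no P∤t with prime⇒irreducible Q-prime (coprime-divisor t⊥P t∣PQ)
  where
    t⊥P : Coprime t P
    t⊥P (d∣t , d∣P) with prime⇒irreducible P-prime d∣P
    ... | inj₁ d≡1 = d≡1
    ... | inj₂ refl = ⊥-elim (P∤t d∣t)
... | inj₁ t≡1 = inj₁ t≡1
... | inj₂ t≡Q = inj₂ (inj₂ (inj₁ t≡Q))

prime⇒3∤ : {R : ℕ} → Prime R → R ≢ 3 → ¬ (3 ∣ R)
prime⇒3∤ R-prime R≢3 3∣R with prime⇒irreducible R-prime 3∣R
... | inj₂ refl = R≢3 refl

prime⇒2≤ : {P : ℕ} → Prime P → 2 ≤ P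
prime⇒2≤ {P} P-prime = nonTrivial⇒n>1 P {{prime⇒nonTrivial P-prime}}

applyUpTo-+ : (f : ℕ → A) (a b : ℕ) → applyUpTo f (a + b) ≡ applyUpTo f a ++ applyUpTo (λ i → f (a + i)) b
applyUpTo-+ f zero    b = refl
applyUpTo-+ f (suc a) b = cong (f 0 ∷_) (applyUpTo-+ (λ i → f (suc i)) a b)

filter-upTo-least : {P : ℕ → Set} (P? : Decidable P) (m k : ℕ) → (∀ d → d < m → ¬ P d) → P m →
  ∃[ ds ] filter P? (upTo (m + suc k)) ≡ m ∷ ds
filter-upTo-least {P = P} P? m k below-m Pm = _ , (begin
  filter P? (upTo (m + suc k))                                    ≡⟨ cong (filter P?) (applyUpTo-+ (λ i → i) m (suc k)) ⟩
  filter P? (upTo m ++ applyUpTo (m +_) (suc k))                  ≡⟨ filter-++ P? (upTo m) _ ⟩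
  filter P? (upTo m) ++ filter P? (applyUpTo (m +_) (suc k))      ≡⟨ cong (_++ filter P? (applyUpTo (m +_) (suc k))) (filter-none P? (All.tabulate (λ d∈ → below-m _ (∈-upTo⁻ d∈)))) ⟩
  filter P? ((m + 0) ∷ applyUpTo (λ i → m + suc i) k)             ≡⟨ filter-accept P? {xs = applyUpTo (λ i → m + suc i) k} (subst P (sym (+-identityʳ m)) Pm) ⟩
  (m + 0) ∷ filter P? (applyUpTo (λ i → m + suc i) k)             ≡⟨ cong (_∷ filter P? (applyUpTo (λ i → m + suc i) k)) (+-identityʳ m) ⟩
  m ∷ filter P? (applyUpTo (λ i → m + suc i) k)                   ∎)
  where open ≡-Reasoning

Λ? : (l : ℕ) → Decidable (λ d → 4 ≤ d × d ∣ l × ¬ (3 ∣ d))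
Λ? l d = (4 ≤? d) ×-dec ((d ∣? l) ×-dec ¬? (3 ∣? d))

δ-≡ : {l d : ℕ} {ds : List ℕ} → filter (Λ? l) (upTo (suc l)) ≡ d ∷ ds → δ l ≡ d
δ-≡ eq rewrite eq = refl

expo-≡ : {l d : ℕ} → δ l ≡ suc d → expo l ≡ 3 * l / suc d
expo-≡ eq rewrite eq = refl

δ-product-of-primes : {P Q : ℕ} → Prime P → Prime Q → 4 ≤ P → P < Q → δ (P * Q) ≡ P
δ-product-of-primes {P} {Q} P-prime Q-prime 4≤P P<Q =
  δ-≡ {l} (subst (λ m → filter (Λ? l) (upTo m) ≡ P ∷ ds) P+[l∸P+1]≡1+l P-least)
  where
    l = P * Q
    P≤l : P ≤ l
    P≤l = m≤m*n P Q {{prime⇒nonZero Q-prime}}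
    P+[l∸P+1]≡1+l : P + suc (l ∸ P) ≡ suc l
    P+[l∸P+1]≡1+l = trans (+-suc P (l ∸ P)) (cong suc (m+[n∸m]≡n P≤l))
    P∈Λ : 4 ≤ P × P ∣ l × ¬ (3 ∣ P)
    P∈Λ = 4≤P , m∣m*n Q , prime⇒3∤ P-prime (λ { refl → <⇒≱ 4≤P ≤-refl })
    below-P : ∀ d → d < P → ¬ (4 ≤ d × d ∣ l × ¬ (3 ∣ d))
    below-P d d<P (4≤d , d∣l , _) with ∣-product-of-primes P-prime Q-prime d∣l
    ... | inj₁ refl               = <⇒≱ (s≤s (s≤s z≤n)) 4≤d
    ... | inj₂ (inj₁ refl)        = <-irrefl refl d<P
    ... | inj₂ (inj₂ (inj₁ refl)) = <-asym d<P P<Q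
    ... | inj₂ (inj₂ (inj₂ refl)) = <⇒≱ d<P P≤l
    ds = proj₁ (filter-upTo-least (Λ? l) P (l ∸ P) below-P P∈Λ)
    P-least = proj₂ (filter-upTo-least (Λ? l) P (l ∸ P) below-P P∈Λ)

expo-product-of-primes : {P Q : ℕ} → Prime P → Prime Q → 4 ≤ P → P < Q → expo (P * Q) ≡ 3 * Q
expo-product-of-primes {P@(suc P′)} {Q} P-prime Q-prime 4≤P P<Q = begin
  expo (P * Q)       ≡⟨ expo-≡ {P * Q} (δ-product-of-primes P-prime Q-prime 4≤P P<Q) ⟩
  3 * (P * Q) / P    ≡⟨ cong (_/ P) (3[PQ]≡3QP P′ Q) ⟩
  3 * Q * P / P      ≡⟨ m*n/n≡m (3 * Q) P ⟩
  3 * Q              ∎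
  where
    open ≡-Reasoning
    3[PQ]≡3QP : ∀ P′ Q → 3 * (suc P′ * Q) ≡ 3 * Q * suc P′
    3[PQ]≡3QP = solve-∀

3P+3Q≤PQ : {P Q : ℕ} → 6 ≤ P → 6 ≤ Q → 3 * P + 3 * Q ≤ P * Q
3P+3Q≤PQ {P} {Q} 6≤P 6≤Q = +-≤-from-halves {3 * P} {3 * Q}
  (subst₂ _≤_ (*-assoc 2 3 P) (*-comm Q P) (*-monoˡ-≤ P 6≤Q))
  (subst (_≤ P * Q) (*-assoc 2 3 Q) (*-monoˡ-≤ Q 6≤P))

module _ {P Q : ℕ} (P-prime : Prime P) (Q-prime : Prime Q) (7≤P : 7 ≤ P) (P<Q : P < Q) where

  private
    6≤P : 6 ≤ P
    6≤P = ≤-trans (n≤1+n 6) 7≤P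
    6≤Q : 6 ≤ Q
    6≤Q = ≤-trans 6≤P (<⇒≤ P<Q)
    1≤P : 1 ≤ P
    1≤P = ≤-trans (s≤s z≤n) 6≤P
    1≤Q : 1 ≤ Q
    1≤Q = ≤-trans (s≤s z≤n) 6≤Q
    3≤P : 3 ≤ P
    3≤P = ≤-trans (s≤s (s≤s (s≤s z≤n))) 6≤P
    3≤Q : 3 ≤ Q
    3≤Q = ≤-trans (s≤s (s≤s (s≤s z≤n))) 6≤Q
    3∤P : ¬ (3 ∣ P)
    3∤P = prime⇒3∤ P-prime (λ { refl → <⇒≱ 6≤P (s≤s (s≤s (s≤s z≤n))) })
    3∤Q : ¬ (3 ∣ Q)
    3∤Q = prime⇒3∤ Q-prime (λ { refl → <⇒≱ 6≤Q (s≤s (s≤s (s≤s z≤n))) })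

  candidates : List (Word n × Word n)
  candidates = map (pair (P * Q) 1) (words 3) ++ map (pair Q P) (words (3 * P)) ++ map (pair P Q) (words (3 * Q))

  Eps2Pair⇒∈candidates : {x : Word n × Word n} → Eps2Pair n (P * Q) x → x ∈ candidates
  Eps2Pair⇒∈candidates {x = p , q} ε with Eps2Pair⇒≡pair ε
  ... | d , t , w , PQ≡dt , 4≤d , len-w , refl with ∣-product-of-primes P-prime Q-prime (divides d PQ≡dt)
  ...   | inj₁ refl =
          ∈-++⁺ˡ (subst (λ k → pair k 1 w ∈ map (pair (P * Q) 1) (words 3)) (trans PQ≡dt (*-identityʳ d))
            (∈-map⁺ (pair (P * Q) 1) (∈-words-of-length len-w)))
  ...   | inj₂ (inj₁ refl) =
          ∈-++⁺ʳ (map (pair (P * Q) 1) (words 3)) (∈-++⁺ˡ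
            (subst (λ k → pair k P w ∈ map (pair Q P) (words (3 * P))) (*-cancelʳ-≡ Q d P {{prime⇒nonZero P-prime}} (trans (*-comm Q P) PQ≡dt))
              (∈-map⁺ (pair Q P) (∈-words-of-length len-w))))
  ...   | inj₂ (inj₂ (inj₁ refl)) =
          ∈-++⁺ʳ (map (pair (P * Q) 1) (words 3)) (∈-++⁺ʳ (map (pair Q P) (words (3 * P)))
            (subst (λ k → pair k Q w ∈ map (pair P Q) (words (3 * Q))) (*-cancelʳ-≡ P d Q {{prime⇒nonZero Q-prime}} PQ≡dt)
              (∈-map⁺ (pair P Q) (∈-words-of-length len-w))))
  ...   | inj₂ (inj₂ (inj₂ refl)) =
          ⊥-elim (<⇒≢ (≤-trans (s≤s (s≤s z≤n)) 4≤d) (sym (*-cancelʳ-≡ d 1 (P * Q) {{m*n≢0 P Q {{prime⇒nonZero P-prime}} {{prime⇒nonZero Q-prime}}}} (trans (sym PQ≡dt) (sym (*-identityˡ (P * Q)))))))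

  length-candidates : length (candidates {n}) ≡ n ^ 3 + (n ^ (3 * P) + n ^ (3 * Q))
  length-candidates {n} = begin
    length (C₁ ++ C₂ ++ C₃)                   ≡⟨ length-++ C₁ ⟩
    length C₁ + length (C₂ ++ C₃)             ≡⟨ cong (length C₁ +_) (length-++ C₂) ⟩
    length C₁ + (length C₂ + length C₃)       ≡⟨ cong₂ _+_ (length-pairs (P * Q) 1 3) (cong₂ _+_ (length-pairs Q P (3 * P)) (length-pairs P Q (3 * Q))) ⟩
    n ^ 3 + (n ^ (3 * P) + n ^ (3 * Q))       ∎
    where
      open ≡-Reasoning
      C₁ = map (pair (P * Q) 1) (words {n} 3)
      C₂ = map (pair Q P) (words {n} (3 * P))
      C₃ = map (pair P Q) (words {n} (3 * Q))
      length-pairs : ∀ d t L → length (map (pair d t) (words {n} L)) ≡ n ^ L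
      length-pairs d t L = trans (length-map (pair d t) (words L)) (length-words L)

  ε₂-upper : {E : ℕ} → HasCard (Eps2Pair n (P * Q)) E → E ≤ n ^ 3 + (n ^ (3 * P) + n ^ (3 * Q))
  ε₂-upper {n} (xs , xs-unique , xs↔ , refl) = subst (length xs ≤_) (length-candidates {n})
    (Unique-⊆⇒length≤ xs (candidates {n}) xs-unique (λ x∈ → Eps2Pair⇒∈candidates (Equivalence.to (xs↔ _) x∈)))

  witnesses : List (Word n × Word n)
  witnesses = map (pair Q P) (primitiveWords (3 * P)) ++ map (pair P Q) (primitiveWords (3 * Q))

  ∈-primitiveWords-P : {w : Word n} → w ∈ primitiveWords (3 * P) → length w ≡ 3 * P × Primitive w
  ∈-primitiveWords-P = ∈-primitiveWords⁻ (3 * P) (≤-trans 1≤P (m≤n*m P 3))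

  ∈-primitiveWords-Q : {w : Word n} → w ∈ primitiveWords (3 * Q) → length w ≡ 3 * Q × Primitive w
  ∈-primitiveWords-Q = ∈-primitiveWords⁻ (3 * Q) (≤-trans 1≤Q (m≤n*m Q 3))

  pair-QP-Eps2Pair : {w : Word n} → w ∈ primitiveWords (3 * P) → Eps2Pair n (P * Q) (pair Q P w)
  pair-QP-Eps2Pair {n} {w} w∈ = let (len-w , prim) = ∈-primitiveWords-P w∈ in
    subst (λ l → Eps2Pair n l (pair Q P w)) (*-comm Q P) (pair-Eps2Pair Q P w prim len-w 1≤P 6≤Q 3∤Q)

  pair-PQ-Eps2Pair : {w : Word n} → w ∈ primitiveWords (3 * Q) → Eps2Pair n (P * Q) (pair P Q w)
  pair-PQ-Eps2Pair {w = w} w∈ = let (len-w , prim) = ∈-primitiveWords-Q w∈ in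
    pair-Eps2Pair P Q w prim len-w 1≤Q 6≤P 3∤P

  witness-Eps2Pair : {x : Word n × Word n} → x ∈ witnesses → Eps2Pair n (P * Q) x
  witness-Eps2Pair {x = x} x∈ with ∈-++⁻ (map (pair Q P) (primitiveWords (3 * P))) x∈
  ... | inj₁ x∈₁ = let (w , w∈ , x≡) = ∈-map⁻ (pair Q P) x∈₁ in subst (Eps2Pair _ (P * Q)) (sym x≡) (pair-QP-Eps2Pair w∈)
  ... | inj₂ x∈₂ = let (w , w∈ , x≡) = ∈-map⁻ (pair P Q) x∈₂ in subst (Eps2Pair _ (P * Q)) (sym x≡) (pair-PQ-Eps2Pair w∈)

  witnesses-unique : Unique (witnesses {n})
  witnesses-unique {n} = UniqueP.++⁺
    (map-Unique (pair Q P) _ (primitiveWords-unique (3 * P)) λ w∈ w′∈ →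
      pair-injective _ _ 3≤Q (trans (proj₁ (∈-primitiveWords-P w∈)) (sym (proj₁ (∈-primitiveWords-P w′∈)))))
    (map-Unique (pair P Q) _ (primitiveWords-unique (3 * Q)) λ w∈ w′∈ →
      pair-injective _ _ 3≤P (trans (proj₁ (∈-primitiveWords-Q w∈)) (sym (proj₁ (∈-primitiveWords-Q w′∈)))))
    disjoint
    where
      3P∤3Q : ¬ (3 * P ∣ 3 * Q)
      3P∤3Q 3P∣3Q with prime⇒irreducible Q-prime (*-cancelˡ-∣ {P} {Q} 3 3P∣3Q)
      ... | inj₁ refl = <⇒≱ (s≤s (s≤s z≤n)) 7≤P
      ... | inj₂ refl = <-irrefl refl P<Q
      disjoint : {x : Word n × Word n} → ¬ (x ∈ map (pair Q P) (primitiveWords (3 * P)) × x ∈ map (pair P Q) (primitiveWords (3 * Q)))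
      disjoint (x∈₁ , x∈₂) with ∈-map⁻ (pair Q P) x∈₁ | ∈-map⁻ (pair P Q) x∈₂
      ... | w , w∈ , refl | w′ , w′∈ , eq = 3P∤3Q (subst₂ _∣_ len-w len-w′
            (pair-≡⇒∣ {d′ = P} {Q} w w′ eq prim 3≤Q (subst (1 ≤_) (sym len-w′) (≤-trans 1≤Q (m≤n*m Q 3)))
              (subst₂ _≤_ (sym (cong₂ _+_ len-w len-w′)) (sym len-q) (3P+3Q≤PQ 6≤P 6≤Q))))
        where
          len-w = proj₁ (∈-primitiveWords-P w∈)
          prim = proj₂ (∈-primitiveWords-P w∈)
          len-w′ = proj₁ (∈-primitiveWords-Q w′∈)
          len-q = proj₁ (proj₂ (proj₂ (proj₂ (pair-QP-Eps2Pair w∈))))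

  ε₂-lower : 2 ≤ n → {E : ℕ} → HasCard (Eps2Pair n (P * Q)) E →
    n ^ (3 * P) + n ^ (3 * Q) ≤ E + (2 * n ^ ⌊ 3 * P /2⌋ + 2 * n ^ ⌊ 3 * Q /2⌋)
  ε₂-lower {n} 2≤n (xs , _ , xs↔ , refl) = begin
    n ^ (3 * P) + n ^ (3 * Q)                     ≤⟨ +-mono-≤ (length-primitiveWords 2≤n (3 * P)) (length-primitiveWords 2≤n (3 * Q)) ⟩
    (length W₁ + B₁) + (length W₂ + B₂)           ≡⟨ +-interchange (length W₁) B₁ (length W₂) B₂ ⟩
    (length W₁ + length W₂) + (B₁ + B₂)           ≡⟨ cong (_+ (B₁ + B₂)) length-witnesses ⟨
    length (witnesses {n}) + (B₁ + B₂)            ≤⟨ +-monoˡ-≤ (B₁ + B₂) (Unique-⊆⇒length≤ witnesses xs witnesses-unique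
                                                       (λ x∈ → Equivalence.from (xs↔ _) (witness-Eps2Pair x∈))) ⟩
    length xs + (B₁ + B₂)                         ∎
    where
      open ≤-Reasoning
      W₁ = primitiveWords {n} (3 * P)
      W₂ = primitiveWords {n} (3 * Q)
      B₁ = 2 * n ^ ⌊ 3 * P /2⌋
      B₂ = 2 * n ^ ⌊ 3 * Q /2⌋
      length-witnesses : length (witnesses {n}) ≡ length W₁ + length W₂
      length-witnesses = trans (length-++ (map (pair Q P) W₁)) (cong₂ _+_ (length-map _ W₁) (length-map _ W₂))

-- Asymptotics

m<n^m : 2 ≤ n → (m : ℕ) → m < n ^ m
m<n^m 2≤n zero    = s≤s z≤n
m<n^m 2≤n (suc m) = ≤-trans (s≤s (subst (suc m ≤_) (sym (+-suc m (m + 0))) (s≤s (m≤m+n m (m + 0)))))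
                           (*-mono-≤ 2≤n (m<n^m 2≤n m))

N*n^a≤n^b : 2 ≤ n → {N a b : ℕ} → N + a ≤ b → N * n ^ a ≤ n ^ b
N*n^a≤n^b {n} 2≤n {N} {a} N+a≤b = begin
  N * n ^ a      ≤⟨ *-monoˡ-≤ (n ^ a) (<⇒≤ (m<n^m 2≤n N)) ⟩
  n ^ N * n ^ a  ≡⟨ ^-distribˡ-+-* n N a ⟨
  n ^ (N + a)    ≤⟨ ^-monoʳ-≤ n {{>-nonZero (≤-trans (s≤s z≤n) 2≤n)}} N+a≤b ⟩
  _              ∎
  where open ≤-Reasoning

⌊3m/2⌋≤2m : (m : ℕ) → ⌊ 3 * m /2⌋ ≤ 2 * m
⌊3m/2⌋≤2m m = subst (⌊ 3 * m /2⌋ ≤_) (sym (n≡⌊n+n/2⌋ (2 * m)))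
  (⌊n/2⌋-mono (subst (3 * m ≤_) (4m≡2m+2m m) (*-monoˡ-≤ m {3} {4} (s≤s (s≤s (s≤s z≤n))))))
  where
    4m≡2m+2m : ∀ m → 4 * m ≡ 2 * m + 2 * m
    4m≡2m+2m = solve-∀

∣-∣≤⊔ : {E M U L : ℕ} → E ≤ M + U → M ≤ E + L → ∣ E - M ∣ ≤ U ⊔ L
∣-∣≤⊔ {E} {M} {U} {L} E≤M+U M≤E+L with ∣m-n∣≡[m∸n]∨[n∸m] E M
... | inj₁ eq = subst (_≤ U ⊔ L) (sym eq) (≤-trans (≤-trans (∸-monoˡ-≤ M E≤M+U) (≤-reflexive (m+n∸m≡n M U))) (m≤m⊔n U L))
... | inj₂ eq = subst (_≤ U ⊔ L) (sym eq) (≤-trans (≤-trans (∸-monoˡ-≤ E M≤E+L) (≤-reflexive (m+n∸m≡n E L))) (m≤n⊔m U L))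

*-∣-∣-≤ : {N E M U L : ℕ} → E ≤ M + U → M ≤ E + L → N * U ≤ M → N * L ≤ M → N * ∣ E - M ∣ ≤ M
*-∣-∣-≤ {N} {E} {M} {U} {L} E≤M+U M≤E+L NU≤M NL≤M = begin
  N * ∣ E - M ∣     ≤⟨ *-monoʳ-≤ N (∣-∣≤⊔ E≤M+U M≤E+L) ⟩
  N * (U ⊔ L)       ≡⟨ *-distribˡ-⊔ N U L ⟩
  N * U ⊔ N * L     ≤⟨ ⊔-lub NU≤M NL≤M ⟩
  M                 ∎
  where open ≤-Reasoning

module _ {n : ℕ} (2≤n : 2 ≤ n) {P Q : ℕ} (P-prime : Prime P) (Q-prime : Prime Q) (7≤P : 7 ≤ P) (P<Q : P < Q)
         {E : ℕ} (card : HasCard (Eps2Pair n (P * Q)) E) {N : ℕ} (4N≤Q : 4 * N ≤ Q) where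

  private
    B = 2 * n ^ ⌊ 3 * P /2⌋ + 2 * n ^ ⌊ 3 * Q /2⌋

    Q+2Q≡3Q : ∀ Q → Q + 2 * Q ≡ 3 * Q
    Q+2Q≡3Q = solve-∀

    N*B≤n^3Q : N * B ≤ n ^ (3 * Q)
    N*B≤n^3Q = begin
      N * (2 * n ^ ⌊ 3 * P /2⌋ + 2 * n ^ ⌊ 3 * Q /2⌋)
        ≤⟨ *-monoʳ-≤ N (+-monoˡ-≤ _ (*-monoʳ-≤ 2 (^-monoʳ-≤ n {{n≢0}} (⌊n/2⌋-mono (*-monoʳ-≤ 3 (<⇒≤ P<Q)))))) ⟩
      N * (2 * n ^ ⌊ 3 * Q /2⌋ + 2 * n ^ ⌊ 3 * Q /2⌋)  ≡⟨ N[2x+2x]≡4Nx N (n ^ ⌊ 3 * Q /2⌋) ⟩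
      4 * N * n ^ ⌊ 3 * Q /2⌋                          ≤⟨ N*n^a≤n^b 2≤n {4 * N} (≤-trans (+-mono-≤ 4N≤Q (⌊3m/2⌋≤2m Q)) (≤-reflexive (Q+2Q≡3Q Q))) ⟩
      n ^ (3 * Q)                                      ∎
      where
        open ≤-Reasoning
        n≢0 = >-nonZero (≤-trans (s≤s z≤n) 2≤n)
        N[2x+2x]≡4Nx : ∀ N x → N * (2 * x + 2 * x) ≡ 4 * N * x
        N[2x+2x]≡4Nx = solve-∀

    upper = ε₂-upper P-prime Q-prime 7≤P P<Q card
    lower = ε₂-lower P-prime Q-prime 7≤P P<Q 2≤n card

  ε₂-near-n^3Q : P + 2 * N ≤ Q → N * ∣ E - n ^ (3 * Q) ∣ ≤ n ^ (3 * Q)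
  ε₂-near-n^3Q P+2N≤Q = *-∣-∣-≤ {N = N} {U = n ^ 3 + n ^ (3 * P)}
    (subst (E ≤_) (a+[b+c]≡c+[a+b] (n ^ 3) (n ^ (3 * P)) (n ^ (3 * Q))) upper)
    (≤-trans (m≤n+m (n ^ (3 * Q)) (n ^ (3 * P))) lower)
    N*U≤n^3Q
    N*B≤n^3Q
    where
      a+[b+c]≡c+[a+b] : ∀ a b c → a + (b + c) ≡ c + (a + b)
      a+[b+c]≡c+[a+b] = solve-∀
      N*U≤n^3Q : N * (n ^ 3 + n ^ (3 * P)) ≤ n ^ (3 * Q)
      N*U≤n^3Q = begin
        N * (n ^ 3 + n ^ (3 * P))        ≤⟨ *-monoʳ-≤ N (+-monoˡ-≤ _ (^-monoʳ-≤ n {{>-nonZero (≤-trans (s≤s z≤n) 2≤n)}} (*-monoʳ-≤ 3 (≤-trans (s≤s z≤n) 7≤P)))) ⟩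
        N * (n ^ (3 * P) + n ^ (3 * P))  ≡⟨ N[x+x]≡2Nx N (n ^ (3 * P)) ⟩
        2 * N * n ^ (3 * P)              ≤⟨ N*n^a≤n^b 2≤n {2 * N} (≤-trans (+-monoˡ-≤ (3 * P) (m≤m+n (2 * N) (4 * N))) (≤-trans (≤-reflexive (6N+3P≡3[P+2N] N P)) (*-monoʳ-≤ 3 P+2N≤Q))) ⟩
        n ^ (3 * Q)                      ∎
        where
          open ≤-Reasoning
          N[x+x]≡2Nx : ∀ N x → N * (x + x) ≡ 2 * N * x
          N[x+x]≡2Nx = solve-∀
          6N+3P≡3[P+2N] : ∀ N P → 2 * N + 4 * N + 3 * P ≡ 3 * (P + 2 * N)
          6N+3P≡3[P+2N] = solve-∀

  ε₂-near-n^3P+n^3Q : N * ∣ E - (n ^ (3 * P) + n ^ (3 * Q)) ∣ ≤ n ^ (3 * P) + n ^ (3 * Q)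
  ε₂-near-n^3P+n^3Q = *-∣-∣-≤ {N = N} {U = n ^ 3}
    (subst (E ≤_) (+-comm (n ^ 3) _) upper)
    lower
    (≤-trans (N*n^a≤n^b 2≤n {N} N+3≤3Q) (m≤n+m (n ^ (3 * Q)) (n ^ (3 * P))))
    (≤-trans N*B≤n^3Q (m≤n+m (n ^ (3 * Q)) (n ^ (3 * P))))
    where
      N+3≤3Q : N + 3 ≤ 3 * Q
      N+3≤3Q = subst (N + 3 ≤_) (Q+2Q≡3Q Q)
        (+-mono-≤ (≤-trans (m≤n*m N 4) 4N≤Q) (≤-trans (s≤s (s≤s (s≤s z≤n))) (≤-trans 7≤P (≤-trans (<⇒≤ P<Q) (m≤n*m Q 2)))))

-- toℚ m normalises m / 1, so facts about it are transported from ℚᵘ, where it is the literal fraction.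
private
  ⟦_⟧ᵘ : ℕ → ℚᵘ.ℚᵘ
  ⟦ m ⟧ᵘ = ℚᵘ.mkℚᵘ (ℤ.+ m) 0

  toℚᵘ-toℚ : (m : ℕ) → ℚ.toℚᵘ (toℚ m) ℚᵘ.≃ ⟦ m ⟧ᵘ
  toℚᵘ-toℚ m = ℚₚ.toℚᵘ-fromℚᵘ ⟦ m ⟧ᵘ

toℚ-+ : (a b : ℕ) → toℚ (a + b) ≡ toℚ a ℚ.+ toℚ b
toℚ-+ a b = ℚₚ.toℚᵘ-injective (ℚᵘₚ.≃-trans (toℚᵘ-toℚ (a + b)) (ℚᵘₚ.≃-sym (ℚᵘₚ.≃-trans (ℚₚ.toℚᵘ-homo-+ (toℚ a) (toℚ b))
  (ℚᵘₚ.≃-trans (ℚᵘₚ.+-cong (toℚᵘ-toℚ a) (toℚᵘ-toℚ b))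
    (ℚᵘₚ.≃-reflexive (cong (λ z → ℚᵘ.mkℚᵘ z 0) (trans (cong₂ ℤ._+_ (ℤₚ.*-identityʳ (ℤ.+ a)) (ℤₚ.*-identityʳ (ℤ.+ b))) (sym (ℤₚ.pos-+ a b)))))))))

toℚ-* : (a b : ℕ) → toℚ (a * b) ≡ toℚ a ℚ.* toℚ b
toℚ-* a b = ℚₚ.toℚᵘ-injective (ℚᵘₚ.≃-trans (toℚᵘ-toℚ (a * b)) (ℚᵘₚ.≃-sym (ℚᵘₚ.≃-trans (ℚₚ.toℚᵘ-homo-* (toℚ a) (toℚ b))
  (ℚᵘₚ.≃-trans (ℚᵘₚ.*-cong (toℚᵘ-toℚ a) (toℚᵘ-toℚ b)) (ℚᵘₚ.≃-reflexive (cong (λ z → ℚᵘ.mkℚᵘ z 0) (sym (ℤₚ.pos-* a b))))))))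

toℚ-mono-≤ : {a b : ℕ} → a ≤ b → toℚ a ℚ.≤ toℚ b
toℚ-mono-≤ {a} {b} a≤b = ℚₚ.toℚᵘ-cancel-≤ (ℚᵘₚ.≤-respʳ-≃ (ℚᵘₚ.≃-sym (toℚᵘ-toℚ b)) (ℚᵘₚ.≤-respˡ-≃ (ℚᵘₚ.≃-sym (toℚᵘ-toℚ a))
  (ℚᵘ.*≤* (subst₂ ℤ._≤_ (sym (ℤₚ.*-identityʳ (ℤ.+ a))) (sym (ℤₚ.*-identityʳ (ℤ.+ b))) (ℤ.+≤+ a≤b)))))

toℚ-nonNeg : (a : ℕ) → ℚ.NonNegative (toℚ a)
toℚ-nonNeg a = ℚ.nonNegative (toℚ-mono-≤ {0} {a} z≤n)

toℚ-∣-∣-≥ : {a b : ℕ} → b ≤ a → ℚ.∣ toℚ a ℚ.- toℚ b ∣ ≡ toℚ ∣ a - b ∣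
toℚ-∣-∣-≥ {a} {b} b≤a = begin
  ℚ.∣ toℚ a ℚ.- toℚ b ∣                  ≡⟨ cong (λ x → ℚ.∣ toℚ x ℚ.- toℚ b ∣) (m+[n∸m]≡n b≤a) ⟨
  ℚ.∣ toℚ (b + (a ∸ b)) ℚ.- toℚ b ∣      ≡⟨ cong (λ x → ℚ.∣ x ℚ.- toℚ b ∣) (toℚ-+ b (a ∸ b)) ⟩
  ℚ.∣ toℚ b ℚ.+ toℚ (a ∸ b) ℚ.- toℚ b ∣  ≡⟨ cong ℚ.∣_∣ (x+y-x≡y (toℚ b) (toℚ (a ∸ b))) ⟩
  ℚ.∣ toℚ (a ∸ b) ∣                      ≡⟨ ℚₚ.0≤p⇒∣p∣≡p (toℚ-mono-≤ {0} {a ∸ b} z≤n) ⟩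
  toℚ (a ∸ b)                            ≡⟨ cong toℚ (m≤n⇒∣n-m∣≡n∸m b≤a) ⟨
  toℚ ∣ a - b ∣                          ∎
  where
    open ≡-Reasoning
    open ℚ-Solver
    x+y-x≡y : ∀ x y → x ℚ.+ y ℚ.- x ≡ y
    x+y-x≡y = solve 2 (λ x y → x :+ y :- x := y) refl

toℚ-∣-∣ : (a b : ℕ) → ℚ.∣ toℚ a ℚ.- toℚ b ∣ ≡ toℚ ∣ a - b ∣
toℚ-∣-∣ a b with ≤-total b a
... | inj₁ b≤a = toℚ-∣-∣-≥ b≤a
... | inj₂ a≤b = begin
  ℚ.∣ toℚ a ℚ.- toℚ b ∣           ≡⟨ cong ℚ.∣_∣ (x-y≡-[y-x] (toℚ a) (toℚ b)) ⟩
  ℚ.∣ ℚ.- (toℚ b ℚ.- toℚ a) ∣     ≡⟨ ℚₚ.∣-p∣≡∣p∣ (toℚ b ℚ.- toℚ a) ⟩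
  ℚ.∣ toℚ b ℚ.- toℚ a ∣           ≡⟨ toℚ-∣-∣-≥ a≤b ⟩
  toℚ ∣ b - a ∣                   ≡⟨ cong toℚ (∣-∣-comm b a) ⟩
  toℚ ∣ a - b ∣                   ∎
  where
    open ≡-Reasoning
    open ℚ-Solver
    x-y≡-[y-x] : ∀ x y → x ℚ.- y ≡ ℚ.- (y ℚ.- x)
    x-y≡-[y-x] = solve 2 (λ x y → x :- y := :- (y :- x)) refl

archimedean : (ε : ℚ.ℚ) → ℚ.0ℚ ℚ.< ε → ∃[ N ] 1ℚ ℚ.≤ ε ℚ.* toℚ N
archimedean ε@(ℚ.mkℚ ℤ.+[1+ a ] b _) _ = suc b ,
  ℚₚ.toℚᵘ-cancel-≤ (ℚᵘₚ.≤-respˡ-≃ (ℚᵘₚ.≃-sym (toℚᵘ-toℚ 1))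
    (ℚᵘₚ.≤-respʳ-≃ (ℚᵘₚ.≃-sym (ℚᵘₚ.≃-trans (ℚₚ.toℚᵘ-homo-* ε (toℚ (suc b))) (ℚᵘₚ.*-congˡ {ℚ.toℚᵘ ε} (toℚᵘ-toℚ (suc b)))))
      (ℚᵘ.*≤* (subst₂ ℤ._≤_ (sym (ℤₚ.*-identityˡ _)) (sym (ℤₚ.*-identityʳ _))
        (ℤ.+≤+ (s≤s (≤-trans (≤-reflexive (*-identityʳ b)) (m≤m+n b _))))))))
archimedean (ℚ.mkℚ (ℤ.+ zero) b _) (ℚ.*<* (ℤ.+<+ ()))
archimedean (ℚ.mkℚ ℤ.-[1+ a ] b _) (ℚ.*<* ())

-- invPow carries a NonZero proof for suc m ^ k, which has to be abstracted along with it.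
toℚ-*-invPow : (m k : ℕ) → toℚ (suc m ^ k) ℚ.* invPow (suc m) k ≡ 1ℚ
toℚ-*-invPow m k with suc m ^ k | m^n≢0 (suc m) k
... | suc B | _ = ℚₚ.toℚᵘ-injective (ℚᵘₚ.≃-trans (ℚₚ.toℚᵘ-homo-* (toℚ (suc B)) (ℤ.+ 1 ℚ./ suc B))
  (ℚᵘₚ.≃-trans (ℚᵘₚ.*-cong (toℚᵘ-toℚ (suc B)) (ℚₚ.toℚᵘ-fromℚᵘ (ℚᵘ.mkℚᵘ (ℤ.+ 1) B)))
    (ℚᵘₚ.≃-sym (ℚᵘₚ.≃-trans (toℚᵘ-toℚ 1) (ℚᵘ.*≡* (cong ℤ.+[1+_] (arith B)))))))
  where
    arith : ∀ B → B + 0 * suc B + 0 * suc (B + 0 * suc B) ≡ B * 1 * 1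
    arith = solve-∀

toℚ-*-[invPow+1] : (n : ℕ) → 1 ≤ n → (A k : ℕ) → toℚ (A * n ^ k) ℚ.* (invPow n k ℚ.+ 1ℚ) ≡ toℚ (A + A * n ^ k)
toℚ-*-[invPow+1] (suc m) _ A k = begin
  toℚ (A * B) ℚ.* (ι ℚ.+ 1ℚ)                       ≡⟨ cong (ℚ._* (ι ℚ.+ 1ℚ)) (toℚ-* A B) ⟩
  toℚ A ℚ.* toℚ B ℚ.* (ι ℚ.+ 1ℚ)                   ≡⟨ distribute (toℚ A) (toℚ B) ι ⟩
  toℚ A ℚ.* (toℚ B ℚ.* ι) ℚ.+ toℚ A ℚ.* toℚ B      ≡⟨ cong (λ z → toℚ A ℚ.* z ℚ.+ toℚ A ℚ.* toℚ B) (toℚ-*-invPow m k) ⟩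
  toℚ A ℚ.* 1ℚ ℚ.+ toℚ A ℚ.* toℚ B                 ≡⟨ cong₂ ℚ._+_ (ℚₚ.*-identityʳ (toℚ A)) (sym (toℚ-* A B)) ⟩
  toℚ A ℚ.+ toℚ (A * B)                            ≡⟨ toℚ-+ A (A * B) ⟨
  toℚ (A + A * B)                                  ∎
  where
    open ≡-Reasoning
    B = suc m ^ k
    ι = invPow (suc m) k
    open ℚ-Solver
    distribute : ∀ a b i → a ℚ.* b ℚ.* (i ℚ.+ 1ℚ) ≡ a ℚ.* (b ℚ.* i) ℚ.+ a ℚ.* b
    distribute = solve 3 (λ a b i → a :* b :* (i :+ con 1ℚ) := a :* (b :* i) :+ a :* b) refl

Eventually : (ℕ → Set) → Set
Eventually P = ∃[ K ] ∀ k → K ≤ k → P k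

Eventually-map : {P R : ℕ → Set} → (∀ {k} → P k → R k) → Eventually P → Eventually R
Eventually-map f (K , P≥K) = K , λ k K≤k → f (P≥K k K≤k)

Eventually-× : {P R : ℕ → Set} → Eventually P → Eventually R → Eventually (λ k → P k × R k)
Eventually-× (K , P≥K) (K′ , R≥K′) = K + K′ , λ k K+K′≤k →
  P≥K k (≤-trans (m≤m+n K K′) K+K′≤k) , R≥K′ k (≤-trans (m≤n+m K′ K) K+K′≤k)

∼-fromℕ : {E M : ℕ → ℕ} → (∀ N → Eventually (λ k → N * ∣ E k - M k ∣ ≤ M k)) → (λ k → toℚ (E k)) ∼ (λ k → toℚ (M k))
∼-fromℕ {E} {M} N-close ε 0<ε with archimedean ε 0<ε
... | N , 1≤εN = Eventually-map within-ε (N-close N)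
  where
    within-ε : ∀ {k} → N * ∣ E k - M k ∣ ≤ M k → ℚ.∣ toℚ (E k) ℚ.- toℚ (M k) ∣ ℚ.≤ ε ℚ.* toℚ (M k)
    within-ε {k} N∣E-M∣≤M = begin
      ℚ.∣ toℚ (E k) ℚ.- toℚ (M k) ∣  ≡⟨ toℚ-∣-∣ (E k) (M k) ⟩
      toℚ D                          ≡⟨ ℚₚ.*-identityˡ (toℚ D) ⟨
      1ℚ ℚ.* toℚ D                   ≤⟨ ℚₚ.*-monoʳ-≤-nonNeg (toℚ D) {{toℚ-nonNeg D}} 1≤εN ⟩
      ε ℚ.* toℚ N ℚ.* toℚ D          ≡⟨ ℚₚ.*-assoc ε (toℚ N) (toℚ D) ⟩
      ε ℚ.* (toℚ N ℚ.* toℚ D)        ≡⟨ cong (ε ℚ.*_) (toℚ-* N D) ⟨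
      ε ℚ.* toℚ (N * D)              ≤⟨ ℚₚ.*-monoˡ-≤-nonNeg ε {{ℚₚ.pos⇒nonNeg ε {{ℚ.positive 0<ε}}}} (toℚ-mono-≤ N∣E-M∣≤M) ⟩
      ε ℚ.* toℚ (M k)                ∎
      where
        open ℚₚ.≤-Reasoning
        D = ∣ E k - M k ∣

∼-respʳ : {a b b′ : ℕ → ℚ.ℚ} → Eventually (λ k → b k ≡ b′ k) → a ∼ b → a ∼ b′
∼-respʳ {a} b≡b′ a∼b ε 0<ε = Eventually-map (λ (b≡ , close) → subst (λ z → ℚ.∣ a _ ℚ.- z ∣ ℚ.≤ ε ℚ.* z) b≡ close)
  (Eventually-× b≡b′ (a∼b ε 0<ε))

StrictlyIncreasing⇒suc≤ : {χ : ℕ → ℕ} → StrictlyIncreasing χ → 1 ≤ χ 0 → ∀ k → suc k ≤ χ k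
StrictlyIncreasing⇒suc≤ χ↑ 1≤χ0 zero    = 1≤χ0
StrictlyIncreasing⇒suc≤ χ↑ 1≤χ0 (suc k) = ≤-trans (s≤s (StrictlyIncreasing⇒suc≤ χ↑ 1≤χ0 k)) (χ↑ k)

module _ {p : ℕ → ℕ} (p-enum : IsPrimeEnum p) where

  private
    p-prime = proj₁ p-enum
    p-increasing = proj₁ (proj₂ p-enum)

  suc≤p : ∀ i → 1 ≤ i → suc i ≤ p i
  suc≤p (suc zero)    _ = prime⇒2≤ (p-prime 0)
  suc≤p (suc (suc j)) _ = ≤-trans (s≤s (suc≤p (suc j) (s≤s z≤n))) (p-increasing j)

  consecutive-primes : ∀ i → 1 ≤ i → Prime (p i) × Prime (p (suc i)) × p i < p (suc i)
  consecutive-primes (suc j) _ = p-prime j , p-prime (suc j) , p-increasing j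

  p∘-eventually-≥ : {χ : ℕ → ℕ} → StrictlyIncreasing χ → (∀ k → 1 ≤ χ k) → (c : ℕ) → Eventually (λ k → c ≤ p (χ k))
  p∘-eventually-≥ {χ} χ↑ 1≤χ c = c , λ k c≤k → ≤-trans c≤k (≤-trans (n≤1+n k)
    (≤-trans (StrictlyIncreasing⇒suc≤ χ↑ (1≤χ 0) k) (<⇒≤ (suc≤p (χ k) (1≤χ k)))))

module _ {n : ℕ} (2≤n : 2 ≤ n) {p : ℕ → ℕ} (p-enum : IsPrimeEnum p) {i : ℕ} (1≤i : 1 ≤ i) (7≤P : 7 ≤ p i) where

  private
    P = p i
    Q = p (suc i)
    P-prime = proj₁ (consecutive-primes {p} p-enum i 1≤i)
    Q-prime = proj₁ (proj₂ (consecutive-primes {p} p-enum i 1≤i))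
    P<Q = proj₂ (proj₂ (consecutive-primes {p} p-enum i 1≤i))
    expo≡3Q : expo (P * Q) ≡ 3 * Q
    expo≡3Q = expo-product-of-primes P-prime Q-prime (≤-trans (s≤s (s≤s (s≤s (s≤s z≤n)))) 7≤P) P<Q

  main-term-bounded-gap : {g : ℕ} → Q ∸ P ≡ g →
    toℚ (n ^ (3 * P) + n ^ (3 * Q)) ≡ toℚ (n ^ expo (P * Q)) ℚ.* (invPow n (3 * g) ℚ.+ 1ℚ)
  main-term-bounded-gap {g} gap≡g = sym (begin
    toℚ (n ^ expo (P * Q)) ℚ.* (invPow n (3 * g) ℚ.+ 1ℚ)            ≡⟨ cong (λ e → toℚ (n ^ e) ℚ.* (invPow n (3 * g) ℚ.+ 1ℚ)) expo≡3Q ⟩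
    toℚ (n ^ (3 * Q)) ℚ.* (invPow n (3 * g) ℚ.+ 1ℚ)                 ≡⟨ cong (λ z → toℚ z ℚ.* (invPow n (3 * g) ℚ.+ 1ℚ)) n^3Q≡ ⟩
    toℚ (n ^ (3 * P) * n ^ (3 * g)) ℚ.* (invPow n (3 * g) ℚ.+ 1ℚ)   ≡⟨ toℚ-*-[invPow+1] n (≤-trans (s≤s z≤n) 2≤n) (n ^ (3 * P)) (3 * g) ⟩
    toℚ (n ^ (3 * P) + n ^ (3 * P) * n ^ (3 * g))                   ≡⟨ cong (λ z → toℚ (n ^ (3 * P) + z)) n^3Q≡ ⟨
    toℚ (n ^ (3 * P) + n ^ (3 * Q))                                 ∎)
    where
      open ≡-Reasoning
      n^3Q≡ : n ^ (3 * Q) ≡ n ^ (3 * P) * n ^ (3 * g)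
      n^3Q≡ = begin
        n ^ (3 * Q)                 ≡⟨ cong (λ z → n ^ (3 * z)) (trans (sym (m+[n∸m]≡n (<⇒≤ P<Q))) (cong (P +_) gap≡g)) ⟩
        n ^ (3 * (P + g))           ≡⟨ cong (n ^_) (*-distribˡ-+ 3 P g) ⟩
        n ^ (3 * P + 3 * g)         ≡⟨ ^-distribˡ-+-* n (3 * P) (3 * g) ⟩
        n ^ (3 * P) * n ^ (3 * g)   ∎

  module _ (ε₂ : ℕ → ℕ) (ε₂-card : ∀ l → HasCard (Eps2Pair n l) (ε₂ l)) {N : ℕ} (4N≤P : 4 * N ≤ P) where

    private
      4N≤Q : 4 * N ≤ Q
      4N≤Q = ≤-trans 4N≤P (<⇒≤ P<Q)

    ε₂-near-main-term-large-gap : 2 * N ≤ Q ∸ P → N * ∣ ε₂ (P * Q) - n ^ expo (P * Q) ∣ ≤ n ^ expo (P * Q)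
    ε₂-near-main-term-large-gap 2N≤gap = subst (λ e → N * ∣ ε₂ (P * Q) - n ^ e ∣ ≤ n ^ e) (sym expo≡3Q)
      (ε₂-near-n^3Q 2≤n P-prime Q-prime 7≤P P<Q (ε₂-card (P * Q)) {N} 4N≤Q
        (subst (P + 2 * N ≤_) (m+[n∸m]≡n (<⇒≤ P<Q)) (+-monoʳ-≤ P 2N≤gap)))

    ε₂-near-main-term-bounded-gap : N * ∣ ε₂ (P * Q) - (n ^ (3 * P) + n ^ (3 * Q)) ∣ ≤ n ^ (3 * P) + n ^ (3 * Q)
    ε₂-near-main-term-bounded-gap = ε₂-near-n^3P+n^3Q 2≤n P-prime Q-prime 7≤P P<Q (ε₂-card (P * Q)) {N} 4N≤Q

corollary4p7 : (n : ℕ) → 2 ≤ n →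
    (p : ℕ → ℕ) → IsPrimeEnum p →
    (g : ℕ) → IsLiminf (λ k → p (suc k) ∸ p k) g →
    (φ ψ : ℕ → ℕ) →
    StrictlyIncreasing φ → (∀ k → 1 ≤ φ k) →
    StrictlyIncreasing ψ → (∀ k → 1 ≤ ψ k) →
    TendsToInfinity (λ k → p (suc (φ k)) ∸ p (φ k)) →
    TendsTo (λ k → p (suc (ψ k)) ∸ p (ψ k)) g →
    (ε₂ : ℕ → ℕ) → (∀ l → HasCard (Eps2Pair n l) (ε₂ l)) →
    ((λ k → toℚ (ε₂ (p (φ k) * p (suc (φ k)))))
        ∼ (λ k → toℚ (n ^ expo (p (φ k) * p (suc (φ k))))))
    × ((λ k → toℚ (ε₂ (p (ψ k) * p (suc (ψ k)))))
        ∼ (λ k → toℚ (n ^ expo (p (ψ k) * p (suc (ψ k))))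
                   *ℚ (invPow n (3 * g) +ℚ 1ℚ)))
corollary4p7 n 2≤n p p-enum g _ φ ψ φ↑ 1≤φ ψ↑ 1≤ψ gap-φ→∞ gap-ψ→g ε₂ ε₂-card =
    ∼-fromℕ {ε₂∘ φ} (λ N → Eventually-map
      (λ ((7≤P , 4N≤P) , 2N≤gap) → ε₂-near-main-term-large-gap 2≤n {p} p-enum (1≤φ _) 7≤P ε₂ ε₂-card {N} 4N≤P 2N≤gap)
      (Eventually-× (Eventually-× (p∘φ≥ 7) (p∘φ≥ (4 * N))) (gap-φ→∞ (2 * N))))
  , ∼-respʳ {a = λ k → toℚ (ε₂∘ ψ k)} {b = λ k → toℚ (main-term ψ k)}
      (Eventually-map (λ (7≤P , gap≡g) → main-term-bounded-gap 2≤n {p} p-enum (1≤ψ _) 7≤P gap≡g) (Eventually-× (p∘ψ≥ 7) gap-ψ→g))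
      (∼-fromℕ {ε₂∘ ψ} {main-term ψ} (λ N → Eventually-map
        (λ (7≤P , 4N≤P) → ε₂-near-main-term-bounded-gap 2≤n {p} p-enum (1≤ψ _) 7≤P ε₂ ε₂-card {N} 4N≤P)
        (Eventually-× (p∘ψ≥ 7) (p∘ψ≥ (4 * N)))))
  where
    ε₂∘ main-term : (ℕ → ℕ) → ℕ → ℕ
    ε₂∘ χ k = ε₂ (p (χ k) * p (suc (χ k)))
    main-term χ k = n ^ (3 * p (χ k)) + n ^ (3 * p (suc (χ k)))
    p∘φ≥ = p∘-eventually-≥ {p} p-enum φ↑ 1≤φ
    p∘ψ≥ = p∘-eventually-≥ {p} p-enum ψ↑ 1≤ψ
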